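{- Let $n\ge 3$, $p\ge 1$, $k\ge1$ be integers and let $S_0$ be a subset of the vertex set of $C_n\odot K_p$ chosen uniformly at random among all subsets of size $C_k(C_n\odot K_p)$. Then the probability $P(\mathrm S)$ that $S_0$ is an irreversible $k$-threshold conversion set of $C_n\odot K_p$ is $$P(\mathrm S)=\begin{cases}\dfrac{n\binom{p}{k-1}^{n-1}\binom{p+1}{k}}{\binom{n(p+1)}{(k-1)n+1}} & \text{if } k\le p+1,\\[12pt] \dfrac{2+(n-2)\,(n \bmod 2)}{\binom{n(p+1)}{pn+\lceil n/2\rceil}} & \text{if } k=p+2,\\[12pt] 1 & \text{if } k\ge p+3.\end{cases}$$
   Context: Irreversible $k$-threshold process on a finite simple graph $G=(V,E)$: start with a set $S_0\subseteq V$ of colored vertices; for $t\ge1$, $S_t$ consists of $S_{t-1}$ together with every vertex having at least $k$ neighbors in $S_{t-1}$. $S_0$ is an irreversible $k$-threshold conversion set if $S_t=V$ for some $t\ge 0$. $C_k(G)$ is the minimum size of such a set; here $C_k(C_n\odot K_p)$ equals $(k-1)n+1$ if $k\le p+1$, $pn+\lceil n/2\rceil$ if $k=p+2$, and $n(p+1)$ if $k\ge p+3$. Corona product $C_n\odot K_p$: take a cycle $C_n$ with vertices $v_1,\dots,v_n$ and $n$ disjoint copies of $K_p$, the $i$-th copy having vertices $u_i^1,\dots,u_i^p$; join $v_i$ to every $u_i^j$. It has $n(p+1)$ vertices. -}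

module Defs where

open import Data.Bool using (Bool; true; false; _∧_; _∨_; if_then_else_)
open import Data.Nat using (ℕ; zero; suc; _+_; _*_; _∸_; _≤_; _<_; z≤n; s≤s; NonZero; ⌈_/2⌉; _≟_; _≤?_; _%_; >-nonZero)
open import Data.Nat.Properties
open import Data.Nat.Combinatorics using (_C_; nCk+nC[k+1]≡[n+1]C[k+1])
open import Data.Fin using (Fin; toℕ; remQuot)
import Data.Fin as F
open import Data.Fin.Subset using (Subset; ∣_∣; _∪_; ⊤; inside; outside)
open import Data.Vec using (Vec; tabulate; lookup)
open import Data.Product using (_×_; _,_; Σ; ∃)
open import Relation.Nullary using (does; ¬_; yes; no)
open import Relation.Binary.PropositionalEquality using (_≡_; refl; subst; sym)

-- A graph on vertex set Fin m is given by its Boolean adjacency function.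
-- (The only graph used, the corona C_n ⊙ K_p below, is symmetric and
-- loopless by construction when n ≥ 3.)

Graph : ℕ → Set
Graph m = Fin m → Fin m → Bool

nbrsIn : ∀ {m} → Graph m → Subset m → Fin m → ℕ
nbrsIn G S v = ∣ tabulate (λ w → G v w ∧ lookup S w) ∣

step : ∀ {m} → Graph m → ℕ → Subset m → Subset m
step G k S = S ∪ tabulate (λ v → does (k ≤? nbrsIn G S v))

process : ∀ {m} → Graph m → ℕ → Subset m → ℕ → Subset m
process G k S zero    = S
process G k S (suc t) = step G k (process G k S t)

IsConversionSet : ∀ {m} → Graph m → ℕ → Subset m → Set
IsConversionSet G k S = ∃ λ t → process G k S t ≡ ⊤

-- Vertex x corresponds to remQuot (suc p) x = (i , a) with i : Fin n,
-- a : Fin (suc p);  a = 0 is the cycle vertex v_i, a = suc j is u_i^j.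

cycSucc : (n : ℕ) → Fin n → Fin n → Bool
cycSucc n i j = does (toℕ j ≟ toℕ i + 1) ∨ (does (toℕ i + 1 ≟ n) ∧ does (toℕ j ≟ 0))

cycAdj : (n : ℕ) → Fin n → Fin n → Bool
cycAdj n i j = cycSucc n i j ∨ cycSucc n j i

sameFin : ∀ {n} → Fin n → Fin n → Bool
sameFin i j = does (toℕ i ≟ toℕ j)

coronaAdj' : (n p : ℕ) → Fin n × Fin (suc p) → Fin n × Fin (suc p) → Bool
coronaAdj' n p (i , F.zero)  (j , F.zero)  = cycAdj n i j
coronaAdj' n p (i , F.zero)  (j , F.suc b) = sameFin i j
coronaAdj' n p (i , F.suc a) (j , F.zero)  = sameFin i j
coronaAdj' n p (i , F.suc a) (j , F.suc b) = sameFin i j ∧ (if sameFin a b then false else true)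

corona : (n p : ℕ) → Graph (n * suc p)
corona n p x y = coronaAdj' n p (remQuot (suc p) x) (remQuot (suc p) y)

Ck : (n p k : ℕ) → ℕ
Ck n p k with k ≤? suc p
... | yes _ = (k ∸ 1) * n + 1
... | no _ with k ≟ suc (suc p)
...   | yes _ = p * n + ⌈ n /2⌉
...   | no _  = n * suc p

Ck≤ : ∀ n p k → 1 ≤ n → Ck n p k ≤ n * suc p
Ck≤ n p k 1≤n with k ≤? suc p
... | yes k≤ = begin
    (k ∸ 1) * n + 1   ≤⟨ +-monoˡ-≤ 1 (*-monoˡ-≤ n (∸-monoˡ-≤ 1 k≤)) ⟩
    p * n + 1         ≤⟨ +-monoʳ-≤ (p * n) 1≤n ⟩
    p * n + n         ≡⟨ +-comm (p * n) n ⟩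
    n + p * n         ≡⟨ *-comm (suc p) n ⟩
    n * suc p         ∎
  where open ≤-Reasoning
... | no _ with k ≟ suc (suc p)
...   | yes _ = begin
    p * n + ⌈ n /2⌉   ≤⟨ +-monoʳ-≤ (p * n) (⌈n/2⌉≤n n) ⟩
    p * n + n         ≡⟨ +-comm (p * n) n ⟩
    n + p * n         ≡⟨ *-comm (suc p) n ⟩
    n * suc p         ∎
  where open ≤-Reasoning
...   | no _  = ≤-refl

C-pos : ∀ n k → k ≤ n → 0 < n C k
C-pos n zero _ = s≤s z≤n
C-pos (suc n) (suc k) (s≤s k≤n) =
  subst (0 <_) (nCk+nC[k+1]≡[n+1]C[k+1] n k) (≤-trans (C-pos n k k≤n) (m≤m+n (n C k) (n C suc k)))

binomNZ : ∀ n p k → 1 ≤ n → NonZero ((n * suc p) C Ck n p k)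
binomNZ n p k 1≤n = >-nonZero (C-pos (n * suc p) (Ck n p k) (Ck≤ n p k 1≤n))

-- "Exactly c subsets S of Fin m satisfy P": an explicit duplicate-free
-- list enumerating them has length c.

open import Data.List using (List; length)
open import Data.List.Membership.Propositional as LM using ()
open import Data.List.Relation.Unary.Unique.Propositional using (Unique)
open import Function.Bundles using (_⇔_)

NumberOf : ∀ {m} → (Subset m → Set) → ℕ → Set
NumberOf {m} P c =
  Σ (List (Subset m)) λ L → Unique L × (∀ S → (S LM.∈ L) ⇔ P S) × length L ≡ c

3≤⇒1≤ : ∀ {n} → 3 ≤ n → 1 ≤ n
3≤⇒1≤ (s≤s _) = s≤s z≤n

{-# OPTIONS --safe #-}
-- Write K = k − 1; the i-th block of C_n ⊙ K_p is the hub v_i with its leaves u_i^1 … u_i^p.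
--
-- For k ≤ p + 1, S converts iff every block contains at least K coloured leaves and some block
-- contains a coloured hub or k coloured leaves. The hub of such a block fires, the colour then runs
-- around the cycle because a hub next to a coloured hub sees 1 + K coloured neighbours, and finally
-- every leaf sees its hub and K other leaves. Conversely, if a block has fewer than K coloured
-- leaves, its other leaves see at most K coloured vertices and never fire. When |S| = Kn + 1 this
-- forces every block to consist of an uncoloured hub and K coloured leaves, except for one block
-- with exactly k coloured vertices: n·C(p,K)^(n−1)·C(p+1,k) sets.
--
-- For k = p + 2 a leaf has only p + 1 neighbours, so all leaves lie in S, and two adjacent hubs
-- outside S block each other; a hub whose two cycle neighbours are coloured does fire. So the
-- conversion sets of size pn + ⌈n/2⌉ are all leaves plus a vertex cover of C_n of size ⌈n/2⌉.
-- Counting the edges covered twice shows that these covers are the two alternating ones for even n,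
-- and for odd n the n covers with exactly one edge covered twice.
--
-- For k ≥ p + 3, C_k is the whole vertex set.

module Submission where

open import Defs
open import Data.Nat
  using ( ℕ; zero; suc; _+_; _*_; _∸_; _^_; _%_; ⌈_/2⌉; _⊔_; _≟_; _≤?_; NonZero
        ; _≤_; _≰_; _<_; z≤n; s≤s; s≤s⁻¹; _≤′_; ≤′-refl; ≤′-step )
open import Data.Nat.Properties
open import Data.Nat.Tactic.RingSolver using (solve-∀)
open import Algebra.Properties.CommutativeMonoid.Sum +-0-commutativeMonoid using (sum-syntax; sum-cong-≗; ∑-distrib-+)
open import Algebra.Properties.CommutativeSemigroup +-commutativeSemigroup using (interchange; x∙yz≈y∙xz; xy∙z≈x∙zy)
open import Data.Nat.Combinatorics using (_C_; nCk+nC[k+1]≡[n+1]C[k+1]; nCn≡1)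
open import Data.Bool using (Bool; true; false; _∧_; _∨_; not; if_then_else_)
open import Data.Bool.Properties
  using (T-≡; T-∨; T-∧; ∨-zeroʳ; ∨-identityʳ; ∨-conicalʳ; ∨-comm; ∨-inverseˡ; ∧-zeroʳ; not-involutive)
import Data.Unit as Unit
open import Data.Fin using (Fin; zero; suc; toℕ; fromℕ; inject₁; combine; remQuot; _↑ˡ_; _↑ʳ_)
open import Data.Fin.Relation.Unary.Top using (view; ‵fromℕ; ‵inject₁)
open import Data.Fin.Induction using (<-weakInduction; <-weakInduction-startingFrom)
open import Data.Fin.Properties
  using (toℕ-injective; remQuot-combine; combine-remQuot; toℕ<n; toℕ-inject₁; toℕ-fromℕ; ≤fromℕ)
import Data.Fin.Properties as Finₚ
open import Data.Fin.Subset using (Subset; ∣_∣; ⊤; _∪_)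
open import Data.Vec using (Vec; []; _∷_; _++_; head; tail; last; tabulate; lookup; splitAt)
open import Data.Vec.Properties
  using ( ++-injective; ++-injectiveˡ; lookup-++ˡ; lookup-++ʳ; lookup-zipWith; lookup-replicate
        ; tabulate-cong; tabulate∘lookup; lookup∘tabulate )
open import Data.Fin.Subset.Properties using (∣p∣≤n; ∣⊤∣≡n; ∣p∣≡n⇒p≡⊤)
open import Data.List as List using (List; length; cartesianProductWith)
open import Data.List.Properties using (length-++; length-map)
open import Data.List.Membership.Propositional.Properties
  using (∈-++⁺ˡ; ∈-++⁺ʳ; ∈-++⁻; ∈-map⁺; ∈-map⁻; ∈-cartesianProductWith⁺; ∈-cartesianProductWith⁻)
open import Data.List.Relation.Unary.Any using (here; there)
open import Data.List.Relation.Unary.AllPairs using ([]; _∷_)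
import Data.List.Relation.Unary.All as All
import Data.List.Relation.Unary.Unique.Propositional.Properties as Unique
open import Data.Product using (Σ; ∃; ∃₂; _×_; _,_; proj₁; proj₂; uncurry)
open import Data.Sum using (_⊎_; inj₁; inj₂; [_,_])
open import Data.Empty using (⊥; ⊥-elim)
open import Function.Bundles using (_⇔_; mk⇔; Equivalence)
open import Function.Construct.Composition using (_⇔-∘_)
open import Function.Construct.Symmetry using (⇔-sym)
open import Data.Product.Function.NonDependent.Propositional using (_×-⇔_)
open import Relation.Nullary using (¬_; yes; no; does)
open import Relation.Binary using (tri<; tri≈; tri>)
open import Relation.Nullary.Decidable using (dec-true; dec-false)
open import Relation.Nullary.Negation using (contradiction)
open import Function using (_∘_; case_of_)
open import Relation.Binary.PropositionalEquality
  using (_≡_; _≢_; _≗_; refl; sym; trans; cong; cong₂; subst; subst₂; module ≡-Reasoning)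

open Equivalence using (to; from)

-- Counting families of subsets

numberOf-⇔ : ∀ {m} {P Q : Subset m → Set} {c} → (∀ S → P S ⇔ Q S) → NumberOf P c → NumberOf Q c
numberOf-⇔ P⇔Q (L , unique , mem , len) = L , unique , (λ S → P⇔Q S ⇔-∘ mem S) , len

numberOf-∅ : ∀ {m} {P : Subset m → Set} → (∀ S → ¬ P S) → NumberOf P 0
numberOf-∅ ¬P = List.[] , [] , (λ S → mk⇔ (λ ()) (λ PS → ⊥-elim (¬P S PS))) , refl

numberOf-singleton : ∀ {m} (T : Subset m) → NumberOf (_≡ T) 1
numberOf-singleton T = List.[ T ] , All.[] ∷ [] , (λ S → mk⇔ (λ { (here S≡T) → S≡T ; (there ()) }) here) , refl

numberOf-⊎ : ∀ {m} {P Q : Subset m → Set} {c d} → (∀ S → P S → Q S → ⊥) →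
  NumberOf P c → NumberOf Q d → NumberOf (λ S → P S ⊎ Q S) (c + d)
numberOf-⊎ disjoint (L , uL , memL , lenL) (M , uM , memM , lenM) =
  L List.++ M ,
  Unique.++⁺ uL uM (λ {S} (S∈L , S∈M) → disjoint S (to (memL S) S∈L) (to (memM S) S∈M)) ,
  (λ S → mk⇔ (λ S∈ → [ (λ S∈L → inj₁ (to (memL S) S∈L)) , (λ S∈M → inj₂ (to (memM S) S∈M)) ] (∈-++⁻ L S∈))
              [ (λ PS → ∈-++⁺ˡ (from (memL S) PS)) , (λ QS → ∈-++⁺ʳ L (from (memM S) QS)) ]) ,
  trans (length-++ L) (cong₂ _+_ lenL lenM)

numberOf-image : ∀ {a b} {P : Subset a → Set} {c} (f : Subset a → Subset b) →
  (∀ {x y} → f x ≡ f y → x ≡ y) → NumberOf P c → NumberOf (λ S → ∃ λ T → P T × S ≡ f T) c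
numberOf-image f f-injective (L , uL , memL , lenL) =
  List.map f L , Unique.map⁺ f-injective uL ,
  (λ S → mk⇔ (λ S∈ → let (T , T∈L , S≡fT) = ∈-map⁻ f S∈ in T , to (memL T) T∈L , S≡fT)
              (λ { (T , PT , refl) → ∈-map⁺ f (from (memL T) PT) })) ,
  trans (length-map f L) lenL

length-cartesianProductWith : ∀ {A B C : Set} (f : A → B → C) (xs : List A) (ys : List B) →
  length (cartesianProductWith f xs ys) ≡ length xs * length ys
length-cartesianProductWith f List.[] ys = refl
length-cartesianProductWith f (x List.∷ xs) ys = begin
  length (List.map (f x) ys List.++ cartesianProductWith f xs ys)
    ≡⟨ length-++ (List.map (f x) ys) ⟩
  length (List.map (f x) ys) + length (cartesianProductWith f xs ys)
    ≡⟨ cong₂ _+_ (length-map (f x) ys) (length-cartesianProductWith f xs ys) ⟩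
  length ys + length xs * length ys ∎
  where open ≡-Reasoning

numberOf-++ : ∀ {a b} {Q : Subset a → Set} {R : Subset b → Set} {c d} →
  NumberOf Q c → NumberOf R d → NumberOf (λ S → ∃₂ λ xs ys → S ≡ xs ++ ys × Q xs × R ys) (c * d)
numberOf-++ (L , uL , memL , lenL) (M , uM , memM , lenM) =
  cartesianProductWith _++_ L M ,
  Unique.cartesianProductWith⁺ _++_ (λ {xs} {xs′} → ++-injective xs xs′) uL uM ,
  (λ S → mk⇔ (λ S∈ → let (xs , ys , xs∈L , ys∈M , S≡) = ∈-cartesianProductWith⁻ _++_ L M S∈
                      in xs , ys , S≡ , to (memL xs) xs∈L , to (memM ys) ys∈M)
              (λ { (xs , ys , refl , Qxs , Rys) → ∈-cartesianProductWith⁺ _++_ (from (memL xs) Qxs) (from (memM ys) Rys) })) ,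
  trans (length-cartesianProductWith _++_ L M) (cong₂ _*_ lenL lenM)

numberOf-size : ∀ m j → NumberOf {m} (λ S → ∣ S ∣ ≡ j) (m C j)
numberOf-size zero zero = numberOf-⇔ (λ { [] → mk⇔ (λ _ → refl) (λ _ → refl) }) (numberOf-singleton [])
numberOf-size zero (suc j) = numberOf-∅ (λ { [] () })
numberOf-size (suc m) zero = numberOf-⇔ split (numberOf-image (false ∷_) (cong tail) (numberOf-size m zero))
  where
  split : ∀ S → (∃ λ T → ∣ T ∣ ≡ 0 × S ≡ false ∷ T) ⇔ (∣ S ∣ ≡ 0)
  split S = mk⇔ (λ { (T , ∣T∣≡0 , refl) → ∣T∣≡0 }) (unfold S)
    where
    unfold : ∀ S → ∣ S ∣ ≡ 0 → ∃ λ T → ∣ T ∣ ≡ 0 × S ≡ false ∷ T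
    unfold (false ∷ T) ∣T∣≡0 = T , ∣T∣≡0 , refl
numberOf-size (suc m) (suc j) = subst (NumberOf _) (nCk+nC[k+1]≡[n+1]C[k+1] m j) (numberOf-⇔ split
  (numberOf-⊎ (λ { S (_ , _ , refl) (_ , _ , ()) })
    (numberOf-image (true ∷_) (cong tail) (numberOf-size m j))
    (numberOf-image (false ∷_) (cong tail) (numberOf-size m (suc j)))))
  where
  split : ∀ S → ((∃ λ T → ∣ T ∣ ≡ j × S ≡ true ∷ T) ⊎ (∃ λ T → ∣ T ∣ ≡ suc j × S ≡ false ∷ T)) ⇔ (∣ S ∣ ≡ suc j)
  split S = mk⇔ (λ { (inj₁ (T , ∣T∣≡j , refl)) → cong suc ∣T∣≡j ; (inj₂ (T , ∣T∣≡1+j , refl)) → ∣T∣≡1+j }) (unfold S)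
    where
    unfold : ∀ S → ∣ S ∣ ≡ suc j → (∃ λ T → ∣ T ∣ ≡ j × S ≡ true ∷ T) ⊎ (∃ λ T → ∣ T ∣ ≡ suc j × S ≡ false ∷ T)
    unfold (true ∷ T) ∣S∣≡1+j = inj₁ (T , suc-injective ∣S∣≡1+j , refl)
    unfold (false ∷ T) ∣S∣≡1+j = inj₂ (T , ∣S∣≡1+j , refl)

bit : Bool → ℕ
bit true  = 1
bit false = 0

bit≤1 : ∀ x → bit x ≤ 1
bit≤1 true  = ≤-refl
bit≤1 false = z≤n

count : ∀ {m} → (Fin m → Bool) → ℕ
count f = ∣ tabulate f ∣

infix 7 _≢ᵇ_

-- Spelled as in coronaAdj', where it decides whether two leaves of a block are adjacent.
_≢ᵇ_ : ∀ {n} → Fin n → Fin n → Bool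
a ≢ᵇ b = if sameFin a b then false else true

∣∷∣ : ∀ {m} x (S : Subset m) → ∣ x ∷ S ∣ ≡ bit x + ∣ S ∣
∣∷∣ true  S = refl
∣∷∣ false S = refl

∣∣≡count : ∀ {m} (S : Subset m) → ∣ S ∣ ≡ count (lookup S)
∣∣≡count S = cong ∣_∣ (sym (tabulate∘lookup S))

count-suc : ∀ {m} (f : Fin (suc m) → Bool) → count f ≡ bit (f zero) + count (f ∘ suc)
count-suc f = ∣∷∣ (f zero) (tabulate (f ∘ suc))

count-cong : ∀ {m} {f g : Fin m → Bool} → f ≗ g → count f ≡ count g
count-cong f≗g = cong ∣_∣ (tabulate-cong f≗g)

count≤ : ∀ {m} (f : Fin m → Bool) → count f ≤ m
count≤ f = ∣p∣≤n (tabulate f)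

bit-mono : ∀ {x y} → (x ≡ true → y ≡ true) → bit x ≤ bit y
bit-mono {false} x⇒y = z≤n
bit-mono {true}  x⇒y with refl ← x⇒y refl = ≤-refl

count-mono : ∀ {m} {f g : Fin m → Bool} → (∀ x → f x ≡ true → g x ≡ true) → count f ≤ count g
count-mono {zero}  f⇒g = z≤n
count-mono {suc m} {f} {g} f⇒g = begin
  count f                          ≡⟨ count-suc f ⟩
  bit (f zero) + count (f ∘ suc)   ≤⟨ +-mono-≤ (bit-mono (f⇒g zero)) (count-mono (f⇒g ∘ suc)) ⟩
  bit (g zero) + count (g ∘ suc)   ≡⟨ count-suc g ⟨
  count g                          ∎
  where open ≤-Reasoning

count-true : ∀ {m} (f : Fin m → Bool) → (∀ x → f x ≡ true) → count f ≡ m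
count-true {zero}  f f≡true = refl
count-true {suc m} f f≡true = begin
  count f                          ≡⟨ count-suc f ⟩
  bit (f zero) + count (f ∘ suc)   ≡⟨ cong₂ _+_ (cong bit (f≡true zero)) (count-true (f ∘ suc) (f≡true ∘ suc)) ⟩
  suc m                            ∎
  where open ≡-Reasoning

count-false : ∀ {m} (f : Fin m → Bool) → (∀ x → f x ≡ false) → count f ≡ 0
count-false {zero}  f f≡false = refl
count-false {suc m} f f≡false = begin
  count f                          ≡⟨ count-suc f ⟩
  bit (f zero) + count (f ∘ suc)   ≡⟨ cong₂ _+_ (cong bit (f≡false zero)) (count-false (f ∘ suc) (f≡false ∘ suc)) ⟩
  0                                ∎
  where open ≡-Reasoning

count<⇒false : ∀ {m} (f : Fin m → Bool) → count f < m → ∃ λ a → f a ≡ false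
count<⇒false {suc m} f count<m with f zero in f0
... | false = zero , f0
... | true  = let (a , fa) = count<⇒false (f ∘ suc) (s≤s⁻¹ count<m) in suc a , fa

sameFin-refl : ∀ {n} (i : Fin n) → sameFin i i ≡ true
sameFin-refl i = dec-true (toℕ i ≟ toℕ i) refl

sameFin⇒≡ : ∀ {n} (i j : Fin n) → sameFin i j ≡ true → i ≡ j
sameFin⇒≡ i j same = toℕ-injective (≡ᵇ⇒≡ (toℕ i) (toℕ j) (from T-≡ same))

≢ᵇ-irrefl : ∀ {n} (i : Fin n) → i ≢ᵇ i ≡ false
≢ᵇ-irrefl i rewrite sameFin-refl i = refl

≢ᵇ-false⇒≡ : ∀ {n} (i j : Fin n) → i ≢ᵇ j ≡ false → i ≡ j
≢ᵇ-false⇒≡ i j _ with sameFin i j in same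
... | true = sameFin⇒≡ i j same

≢⇒≢ᵇ : ∀ {n} {i j : Fin n} → i ≢ j → i ≢ᵇ j ≡ true
≢⇒≢ᵇ {i = i} {j} i≢j with sameFin i j in same
... | true  = ⊥-elim (i≢j (sameFin⇒≡ i j same))
... | false = refl

count-remove : ∀ {m} (f : Fin m → Bool) (a : Fin m) → count f ≡ bit (f a) + count (λ b → a ≢ᵇ b ∧ f b)
count-remove f zero = count-suc f
count-remove f (suc a) = begin
  count f                                                         ≡⟨ count-suc f ⟩
  bit (f zero) + count (f ∘ suc)                                  ≡⟨ cong (bit (f zero) +_) (count-remove (f ∘ suc) a) ⟩
  bit (f zero) + (bit (f (suc a)) + count (λ b → a ≢ᵇ b ∧ f (suc b))) ≡⟨ x∙yz≈y∙xz (bit (f zero)) (bit (f (suc a))) _ ⟩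
  bit (f (suc a)) + (bit (f zero) + count (λ b → a ≢ᵇ b ∧ f (suc b)))
    ≡⟨ cong (bit (f (suc a)) +_) (count-suc (λ b → suc a ≢ᵇ b ∧ f b)) ⟨
  bit (f (suc a)) + count (λ b → suc a ≢ᵇ b ∧ f b)                ∎
  where open ≡-Reasoning

count≥1 : ∀ {m} (f : Fin m → Bool) {a} → f a ≡ true → 1 ≤ count f
count≥1 f {a} fa = begin
  1                                        ≡⟨ cong bit fa ⟨
  bit (f a)                                ≤⟨ m≤m+n (bit (f a)) _ ⟩
  bit (f a) + count (λ b → a ≢ᵇ b ∧ f b)   ≡⟨ count-remove f a ⟨
  count f                                  ∎
  where open ≤-Reasoning

count≥2 : ∀ {m} (f : Fin m → Bool) {a b} → a ≢ b → f a ≡ true → f b ≡ true → 2 ≤ count f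
count≥2 f {a} {b} a≢b fa fb = begin
  2                                        ≤⟨ +-mono-≤ (≤-reflexive (cong bit (sym fa))) (count≥1 _ {b} fb′) ⟩
  bit (f a) + count (λ c → a ≢ᵇ c ∧ f c)   ≡⟨ count-remove f a ⟨
  count f                                  ∎
  where
  open ≤-Reasoning
  fb′ : a ≢ᵇ b ∧ f b ≡ true
  fb′ rewrite ≢⇒≢ᵇ a≢b = fb

count≤1 : ∀ {m} (f : Fin m → Bool) → (∀ x y → f x ≡ true → f y ≡ true → x ≡ y) → count f ≤ 1
count≤1 {zero} f unique = z≤n
count≤1 {suc m} f unique with f zero in f0
... | false = count≤1 (f ∘ suc) (λ x y fx fy → Finₚ.suc-injective (unique (suc x) (suc y) fx fy))
... | true  = ≤-reflexive (cong suc (count-false (f ∘ suc) ≢zero))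
  where
  ≢zero : ∀ x → f (suc x) ≡ false
  ≢zero x with f (suc x) in fx
  ... | false = refl
  ... | true with () ← unique zero (suc x) f0 fx

bit-∨ : ∀ x y → bit (x ∨ y) ≤ bit x + bit y
bit-∨ true  y = s≤s z≤n
bit-∨ false y = ≤-refl

count-∨ : ∀ {m} (f g : Fin m → Bool) → count (λ x → f x ∨ g x) ≤ count f + count g
count-∨ {zero} f g = z≤n
count-∨ {suc m} f g = begin
  count (λ x → f x ∨ g x)                                            ≡⟨ count-suc (λ x → f x ∨ g x) ⟩
  bit (f zero ∨ g zero) + count (λ x → f (suc x) ∨ g (suc x))
    ≤⟨ +-mono-≤ (bit-∨ (f zero) (g zero)) (count-∨ (f ∘ suc) (g ∘ suc)) ⟩
  (bit (f zero) + bit (g zero)) + (count (f ∘ suc) + count (g ∘ suc)) ≡⟨ interchange (bit (f zero)) _ _ _ ⟩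
  (bit (f zero) + count (f ∘ suc)) + (bit (g zero) + count (g ∘ suc)) ≡⟨ cong₂ _+_ (count-suc f) (count-suc g) ⟨
  count f + count g                                                  ∎
  where open ≤-Reasoning

∣++∣ : ∀ {a b} (xs : Subset a) (ys : Subset b) → ∣ xs ++ ys ∣ ≡ ∣ xs ∣ + ∣ ys ∣
∣++∣ []       ys = refl
∣++∣ (x ∷ xs) ys = begin
  ∣ x ∷ xs ++ ys ∣            ≡⟨ ∣∷∣ x (xs ++ ys) ⟩
  bit x + ∣ xs ++ ys ∣        ≡⟨ cong (bit x +_) (∣++∣ xs ys) ⟩
  bit x + (∣ xs ∣ + ∣ ys ∣)   ≡⟨ +-assoc (bit x) _ _ ⟨
  (bit x + ∣ xs ∣) + ∣ ys ∣   ≡⟨ cong (_+ ∣ ys ∣) (∣∷∣ x xs) ⟨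
  ∣ x ∷ xs ∣ + ∣ ys ∣         ∎
  where open ≡-Reasoning

count-↑ : ∀ a {b} (f : Fin (a + b) → Bool) → count f ≡ count (λ x → f (x ↑ˡ b)) + count (λ y → f (a ↑ʳ y))
count-↑ zero    f = refl
count-↑ (suc a) {b} f = begin
  count f                                                                ≡⟨ count-suc f ⟩
  bit (f zero) + count (f ∘ suc)                                         ≡⟨ cong (bit (f zero) +_) (count-↑ a (f ∘ suc)) ⟩
  bit (f zero) + (count (λ x → f (suc (x ↑ˡ b))) + count (λ y → f (suc a ↑ʳ y))) ≡⟨ +-assoc (bit (f zero)) _ _ ⟨
  (bit (f zero) + count (λ x → f (suc (x ↑ˡ b)))) + count (λ y → f (suc a ↑ʳ y))
    ≡⟨ cong (_+ count (λ y → f (suc a ↑ʳ y))) (count-suc (λ x → f (x ↑ˡ b))) ⟨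
  count (λ x → f (x ↑ˡ b)) + count (λ y → f (suc a ↑ʳ y))                       ∎
  where open ≡-Reasoning

count-combine : ∀ n {m} (f : Fin (n * m) → Bool) → count f ≡ ∑[ i < n ] count (λ b → f (combine i b))
count-combine zero    f = refl
count-combine (suc n) {m} f =
  trans (count-↑ m f) (cong (count (λ x → f (x ↑ˡ n * m)) +_) (count-combine n (λ y → f (m ↑ʳ y))))

sum-bit : ∀ {n} (f : Fin n → Bool) → ∑[ i < n ] bit (f i) ≡ count f
sum-bit {zero}  f = refl
sum-bit {suc n} f = trans (cong (bit (f zero) +_) (sum-bit (f ∘ suc))) (sym (count-suc f))

sum-const : ∀ n c → ∑[ i < n ] c ≡ n * c
sum-const zero    c = refl
sum-const (suc n) c = cong (c +_) (sum-const n c)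

sum-sameFin : ∀ {n} (i : Fin n) (g : Fin n → ℕ) → ∑[ j < n ] (if sameFin i j then g j else 0) ≡ g i
sum-sameFin {suc n} zero g = trans (cong (g zero +_) (trans (sum-const n 0) (*-zeroʳ n))) (+-identityʳ (g zero))
sum-sameFin (suc i)  g = sum-sameFin i (g ∘ suc)

lookup-ext : ∀ {A : Set} {m} (xs ys : Vec A m) → lookup xs ≗ lookup ys → xs ≡ ys
lookup-ext xs ys eq = trans (sym (tabulate∘lookup xs)) (trans (tabulate-cong eq) (tabulate∘lookup ys))

upperBound : ∀ {m} (t : Fin m → ℕ) → ∃ λ T → ∀ x → t x ≤ T
upperBound {zero}  t = 0 , λ ()
upperBound {suc m} t with T , t≤T ← upperBound (t ∘ suc) =
  t zero ⊔ T , λ { zero → m≤m⊔n (t zero) T ; (suc x) → ≤-trans (t≤T x) (m≤n⊔m (t zero) T) }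

-- The irreversible threshold process on an arbitrary graph

infix 4 _⊆ᵇ_

_⊆ᵇ_ : ∀ {m} → Subset m → Subset m → Set
S ⊆ᵇ T = ∀ x → lookup S x ≡ true → lookup T x ≡ true

⊆ᵇ-false : ∀ {m} {S T : Subset m} {x} → S ⊆ᵇ T → lookup T x ≡ false → lookup S x ≡ false
⊆ᵇ-false {S = S} {x = x} S⊆T Tx with lookup S x in Sx
... | false = refl
... | true  with () ← trans (sym (S⊆T x Sx)) Tx

lookup-∪ : ∀ {m} (S T : Subset m) x → lookup (S ∪ T) x ≡ lookup S x ∨ lookup T x
lookup-∪ S T x = lookup-zipWith _∨_ x S T

⊆ᵇ-∪ˡ : ∀ {m} (S T : Subset m) → S ⊆ᵇ S ∪ T
⊆ᵇ-∪ˡ S T x Sx rewrite lookup-∪ S T x | Sx = refl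

module _ {m} (G : Graph m) (k : ℕ) where

  lookup-step : ∀ S x → lookup (step G k S) x ≡ lookup S x ∨ does (k ≤? nbrsIn G S x)
  lookup-step S x = trans (lookup-∪ S _ x) (cong (lookup S x ∨_) (lookup∘tabulate _ x))

  nbrsIn-mono : ∀ {S T} → S ⊆ᵇ T → ∀ v → nbrsIn G S v ≤ nbrsIn G T v
  nbrsIn-mono {S} {T} S⊆T v =
    count-mono {f = λ w → G v w ∧ lookup S w} {g = λ w → G v w ∧ lookup T w} λ w → ∧-mono (G v w) (S⊆T w)
    where
    ∧-mono : ∀ x {y z} → (y ≡ true → z ≡ true) → x ∧ y ≡ true → x ∧ z ≡ true
    ∧-mono true y⇒z = y⇒z

  process-mono : ∀ S {t t′} → t ≤ t′ → process G k S t ⊆ᵇ process G k S t′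
  process-mono S t≤t′ = go (≤⇒≤′ t≤t′)
    where
    go : ∀ {t t′} → t ≤′ t′ → process G k S t ⊆ᵇ process G k S t′
    go ≤′-refl                           = λ x Px → Px
    go {t′ = suc t′} (≤′-step t≤′t′) x Px = ⊆ᵇ-∪ˡ (process G k S t′) _ x (go t≤′t′ x Px)

  S⊆process : ∀ S t → S ⊆ᵇ process G k S t
  S⊆process S t = process-mono S {0} {t} z≤n

  EventuallyColoured : Subset m → Fin m → Set
  EventuallyColoured S x = ∃ λ t → lookup (process G k S t) x ≡ true

  coloured-by-threshold : ∀ S t x → k ≤ nbrsIn G (process G k S t) x → EventuallyColoured S x
  coloured-by-threshold S t x k≤ = suc t , (begin
    lookup (step G k (process G k S t)) x                              ≡⟨ lookup-step (process G k S t) x ⟩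
    lookup (process G k S t) x ∨ does (k ≤? nbrsIn G (process G k S t) x)
      ≡⟨ cong (lookup (process G k S t) x ∨_) (dec-true (k ≤? _) k≤) ⟩
    lookup (process G k S t) x ∨ true                                  ≡⟨ ∨-zeroʳ _ ⟩
    true                                                               ∎)
    where open ≡-Reasoning

  eventually-coloured⇒conversion : ∀ S → (∀ x → EventuallyColoured S x) → IsConversionSet G k S
  eventually-coloured⇒conversion S coloured with T , t≤T ← upperBound (proj₁ ∘ coloured) =
    T , lookup-ext _ ⊤ λ x → trans (process-mono S (t≤T x) x (proj₂ (coloured x))) (sym (lookup-replicate x true))

  Closed : Subset m → Set
  Closed T = ∀ x → lookup T x ≡ false → nbrsIn G T x < k

  process⊆closed : ∀ {S T} → S ⊆ᵇ T → Closed T → ∀ t → process G k S t ⊆ᵇ T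
  process⊆closed S⊆T closed zero = S⊆T
  process⊆closed {S} {T} S⊆T closed (suc t) x Px with lookup T x in Tx
  ... | true  = refl
  ... | false = contradiction (begin
    true                                    ≡⟨ Px ⟨
    lookup (step G k P) x                   ≡⟨ lookup-step P x ⟩
    lookup P x ∨ does (k ≤? nbrsIn G P x)   ≡⟨ cong₂ _∨_ (⊆ᵇ-false {S = P} {T} P⊆T Tx) (dec-false (k ≤? _) (<⇒≱ few)) ⟩
    false                                   ∎) λ ()
    where
    open ≡-Reasoning
    P : Subset m
    P = process G k S t
    P⊆T : P ⊆ᵇ T
    P⊆T = process⊆closed {S} {T} S⊆T closed t
    few : nbrsIn G P x < k
    few = ≤-<-trans (nbrsIn-mono {P} {T} P⊆T x) (closed x Tx)

  closed⇒¬conversion : ∀ {S T} → S ⊆ᵇ T → Closed T → ∀ x → lookup T x ≡ false → ¬ IsConversionSet G k S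
  closed⇒¬conversion {S} {T} S⊆T closed x Tx (t , Pt≡⊤) =
    contradiction (trans (sym (process⊆closed {S} {T} S⊆T closed t x coloured)) Tx) λ ()
    where
    coloured : lookup (process G k S t) x ≡ true
    coloured = trans (cong (λ P → lookup P x) Pt≡⊤) (lookup-replicate x true)

cycSucc-intro : ∀ n {i j : Fin n} → toℕ j ≡ suc (toℕ i) → cycSucc n i j ≡ true
cycSucc-intro n {i} {j} j≡1+i =
  cong (_∨ (does (toℕ i + 1 ≟ n) ∧ does (toℕ j ≟ 0))) (dec-true (toℕ j ≟ toℕ i + 1) (trans j≡1+i (+-comm 1 (toℕ i))))

cycSucc-wrap : ∀ n {i j : Fin n} → suc (toℕ i) ≡ n → toℕ j ≡ 0 → cycSucc n i j ≡ true
cycSucc-wrap n {i} {j} 1+i≡n j≡0 = trans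
  (cong₂ (λ a b → does (toℕ j ≟ toℕ i + 1) ∨ (a ∧ b))
         (dec-true (toℕ i + 1 ≟ n) (trans (+-comm (toℕ i) 1) 1+i≡n)) (dec-true (toℕ j ≟ 0) j≡0))
  (∨-zeroʳ _)

cycSucc-inv : ∀ n (i j : Fin n) → cycSucc n i j ≡ true → toℕ j ≡ suc (toℕ i) ⊎ (suc (toℕ i) ≡ n × toℕ j ≡ 0)
cycSucc-inv n i j succ with to T-∨ (from T-≡ succ)
... | inj₁ j≡i+1 = inj₁ (trans (≡ᵇ⇒≡ _ _ j≡i+1) (+-comm (toℕ i) 1))
... | inj₂ wrap with i+1≡n , j≡0 ← to T-∧ wrap =
  inj₂ (trans (+-comm 1 (toℕ i)) (≡ᵇ⇒≡ _ _ i+1≡n) , ≡ᵇ⇒≡ _ _ j≡0)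

cycSucc⇒cycAdj : ∀ n (i j : Fin n) → cycSucc n i j ≡ true → cycAdj n i j ≡ true
cycSucc⇒cycAdj n i j succ = cong (_∨ cycSucc n j i) succ

cycAdj-sym : ∀ n (i j : Fin n) → cycAdj n i j ≡ cycAdj n j i
cycAdj-sym n i j = ∨-comm (cycSucc n i j) (cycSucc n j i)

cycSucc-inject₁ : ∀ {n} (i : Fin n) → cycSucc (suc n) (inject₁ i) (suc i) ≡ true
cycSucc-inject₁ {n} i = cycSucc-intro (suc n) {inject₁ i} {suc i} (cong suc (sym (toℕ-inject₁ i)))

cycSucc-fromℕ : ∀ n → cycSucc (suc n) (fromℕ n) zero ≡ true
cycSucc-fromℕ n = cycSucc-wrap (suc n) {fromℕ n} {zero} (cong suc (toℕ-fromℕ n)) refl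

cycNext : ∀ {n} → Fin n → Fin n
cycNext {suc n} i with view i
... | ‵fromℕ     = zero
... | ‵inject₁ j = suc j

cycPrev : ∀ {n} → Fin n → Fin n
cycPrev {suc n} zero    = fromℕ n
cycPrev {suc n} (suc j) = inject₁ j

cycSucc-cycNext : ∀ {n} (i : Fin n) → cycSucc n i (cycNext i) ≡ true
cycSucc-cycNext {suc n} i with view i
... | ‵fromℕ     = cycSucc-fromℕ n
... | ‵inject₁ j = cycSucc-inject₁ j

cycSucc-cycPrev : ∀ {n} (i : Fin n) → cycSucc n (cycPrev i) i ≡ true
cycSucc-cycPrev {suc n} zero    = cycSucc-fromℕ n
cycSucc-cycPrev {suc n} (suc j) = cycSucc-inject₁ j

cycSucc-functional : ∀ n (i j j′ : Fin n) → cycSucc n i j ≡ true → cycSucc n i j′ ≡ true → j ≡ j′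
cycSucc-functional n i j j′ succ succ′ with cycSucc-inv n i j succ | cycSucc-inv n i j′ succ′
... | inj₁ j≡1+i       | inj₁ j′≡1+i       = toℕ-injective (trans j≡1+i (sym j′≡1+i))
... | inj₁ j≡1+i       | inj₂ (1+i≡n , _)  = contradiction (trans j≡1+i 1+i≡n) (<⇒≢ (toℕ<n j))
... | inj₂ (1+i≡n , _) | inj₁ j′≡1+i       = contradiction (trans j′≡1+i 1+i≡n) (<⇒≢ (toℕ<n j′))
... | inj₂ (_ , j≡0)   | inj₂ (_ , j′≡0)   = toℕ-injective (trans j≡0 (sym j′≡0))

cycSucc-injective : ∀ n (i i′ j : Fin n) → cycSucc n i j ≡ true → cycSucc n i′ j ≡ true → i ≡ i′
cycSucc-injective n i i′ j succ succ′ with cycSucc-inv n i j succ | cycSucc-inv n i′ j succ′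
... | inj₁ j≡1+i        | inj₁ j≡1+i′        = toℕ-injective (suc-injective (trans (sym j≡1+i) j≡1+i′))
... | inj₁ j≡1+i        | inj₂ (_ , j≡0)     = contradiction (trans (sym j≡1+i) j≡0) λ ()
... | inj₂ (_ , j≡0)    | inj₁ j≡1+i′        = contradiction (trans (sym j≡1+i′) j≡0) λ ()
... | inj₂ (1+i≡n , _)  | inj₂ (1+i′≡n , _)  = toℕ-injective (suc-injective (trans 1+i≡n (sym 1+i′≡n)))

cycSucc-asym : ∀ n (i j : Fin n) → 3 ≤ n → cycSucc n i j ≡ true → cycSucc n j i ≡ true → ⊥
cycSucc-asym n i j 3≤n succ succ′ = <⇒≱ 3≤n (n≤2 (cycSucc-inv n i j succ) (cycSucc-inv n j i succ′))
  where
  n≤2 : toℕ j ≡ suc (toℕ i) ⊎ (suc (toℕ i) ≡ n × toℕ j ≡ 0) → toℕ i ≡ suc (toℕ j) ⊎ (suc (toℕ j) ≡ n × toℕ i ≡ 0) → n ≤ 2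
  n≤2 (inj₁ j≡1+i) (inj₁ i≡1+j) =
    contradiction (≤-trans (n≤1+n (suc (toℕ i))) (≤-reflexive (sym (trans i≡1+j (cong suc j≡1+i))))) 1+n≰n
  n≤2 (inj₁ j≡1+i)         (inj₂ (1+j≡n , i≡0)) = ≤-reflexive (trans (sym 1+j≡n) (cong suc (trans j≡1+i (cong suc i≡0))))
  n≤2 (inj₂ (1+i≡n , j≡0)) (inj₁ i≡1+j)         = ≤-reflexive (trans (sym 1+i≡n) (cong suc (trans i≡1+j (cong suc j≡0))))
  n≤2 (inj₂ (_ , j≡0))     (inj₂ (1+j≡n , _))   = ≤-trans (≤-reflexive (trans (sym 1+j≡n) (cong suc j≡0))) (n≤1+n 1)

cycDegree≤2 : ∀ n (i : Fin n) → count (cycAdj n i) ≤ 2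
cycDegree≤2 n i = ≤-trans (count-∨ (cycSucc n i) (λ j → cycSucc n j i))
  (+-mono-≤ (count≤1 (cycSucc n i) (cycSucc-functional n i))
            (count≤1 (λ j → cycSucc n j i) (λ j j′ → cycSucc-injective n j j′ i)))

cycNext≢cycPrev : ∀ {n} → 3 ≤ n → (i : Fin n) → cycNext i ≢ cycPrev i
cycNext≢cycPrev {n} 3≤n i next≡prev = cycSucc-asym n i (cycNext i) 3≤n (cycSucc-cycNext i)
  (subst (λ j → cycSucc n j i ≡ true) (sym next≡prev) (cycSucc-cycPrev i))

-- Walk forward from i₀ to the last vertex, across the closing edge to 0, and forward again.
cycle-connected : ∀ {n} (P : Fin n → Set) → (∀ i j → cycSucc n i j ≡ true → P i → P j) →
  ∀ {i₀} → P i₀ → ∀ i → P i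
cycle-connected {suc n} P spread {i₀} Pi₀ = <-weakInduction P P₀ forward
  where
  forward : ∀ i → P (inject₁ i) → P (suc i)
  forward i = spread (inject₁ i) (suc i) (cycSucc-inject₁ i)
  P₀ : P zero
  P₀ = spread (fromℕ n) zero (cycSucc-fromℕ n) (<-weakInduction-startingFrom P Pi₀ forward (≤fromℕ i₀))

-- Subsets of Fin (n * m) as n consecutive blocks of size m

block : ∀ {n m} → Subset (n * m) → Fin n → Subset m
block S i = tabulate (λ b → lookup S (combine i b))

block-++-zero : ∀ {n m} (xs : Subset m) (ys : Subset (n * m)) → block {suc n} (xs ++ ys) zero ≡ xs
block-++-zero xs ys = trans (tabulate-cong (lookup-++ˡ xs ys)) (tabulate∘lookup xs)

block-++-suc : ∀ {n m} (xs : Subset m) (ys : Subset (n * m)) i → block {suc n} (xs ++ ys) (suc i) ≡ block ys i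
block-++-suc xs ys i = tabulate-cong (λ b → lookup-++ʳ xs ys (combine i b))

AllBlocks : ∀ {m} → (Subset m → Set) → ∀ n → Subset (n * m) → Set
AllBlocks Q zero    S = S ≡ []
AllBlocks Q (suc n) S = ∃₂ λ xs ys → S ≡ xs ++ ys × Q xs × AllBlocks Q n ys

OneBlock : ∀ {m} → (Subset m → Set) → (Subset m → Set) → ∀ n → Subset (n * m) → Set
OneBlock Q R zero    S = ⊥
OneBlock Q R (suc n) S = (∃₂ λ xs ys → S ≡ xs ++ ys × R xs × AllBlocks Q n ys)
                       ⊎ (∃₂ λ xs ys → S ≡ xs ++ ys × Q xs × OneBlock Q R n ys)

numberOf-AllBlocks : ∀ {m} {Q : Subset m → Set} {c} → NumberOf Q c → ∀ n → NumberOf (AllBlocks Q n) (c ^ n)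
numberOf-AllBlocks #Q zero    = numberOf-singleton []
numberOf-AllBlocks #Q (suc n) = numberOf-++ #Q (numberOf-AllBlocks #Q n)

oneBlock-recurrence : ∀ n c d → d * c ^ n + c * (n * c ^ (n ∸ 1) * d) ≡ suc n * c ^ n * d
oneBlock-recurrence zero    c d = identity c d
  where
  identity : ∀ c d → d * 1 + c * 0 ≡ 1 * 1 * d
  identity = solve-∀
oneBlock-recurrence (suc n) c d = identity n (c ^ n) c d
  where
  identity : ∀ n x c d → d * (c * x) + c * (suc n * x * d) ≡ suc (suc n) * (c * x) * d
  identity = solve-∀

numberOf-OneBlock : ∀ {m} {Q R : Subset m → Set} {c d} → (∀ xs → Q xs → R xs → ⊥) →
  NumberOf Q c → NumberOf R d → ∀ n → NumberOf (OneBlock Q R n) (n * c ^ (n ∸ 1) * d)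
numberOf-OneBlock disjoint #Q #R zero    = numberOf-∅ (λ _ ())
numberOf-OneBlock {Q = Q} {R} {c} {d} disjoint #Q #R (suc n) =
  subst (NumberOf _) (oneBlock-recurrence n c d)
    (numberOf-⊎ first-block-differs
      (numberOf-++ #R (numberOf-AllBlocks #Q n))
      (numberOf-++ #Q (numberOf-OneBlock disjoint #Q #R n)))
  where
  first-block-differs : ∀ S → (∃₂ λ xs ys → S ≡ xs ++ ys × R xs × AllBlocks Q n ys) →
                              (∃₂ λ xs ys → S ≡ xs ++ ys × Q xs × OneBlock Q R n ys) → ⊥
  first-block-differs S (xs , ys , refl , Rxs , _) (xs′ , ys′ , S≡ , Qxs′ , _)
    with refl ← ++-injectiveˡ xs xs′ S≡ = disjoint xs Qxs′ Rxs

tight-+ : ∀ {a b c d} → c ≤ a → d ≤ b → a + b ≡ c + d → a ≡ c × b ≡ d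
tight-+ {a} {b} {c} {d} c≤a d≤b sum≡ = a≡c , +-cancelˡ-≡ c b d (trans (cong (_+ b) (sym a≡c)) sum≡)
  where
  a≡c : a ≡ c
  a≡c = ≤-antisym (+-cancelʳ-≤ b a c (≤-trans (≤-reflexive sum≡) (+-monoʳ-≤ c d≤b))) c≤a

tight-+-suc : ∀ {a b c d} → c ≤ a → d ≤ b → a + b ≡ suc (c + d) → (a ≡ suc c × b ≡ d) ⊎ (a ≡ c × b ≡ suc d)
tight-+-suc {a} {b} {c} {d} c≤a d≤b sum≡ with m≤n⇒m<n∨m≡n c≤a
... | inj₁ c<a = inj₁ (tight-+ c<a d≤b sum≡)
... | inj₂ refl = inj₂ (refl , +-cancelˡ-≡ c b (suc d) (trans sum≡ (sym (+-suc c d))))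

module _ {m : ℕ} where

  blocks-∷ : ∀ (P : Subset m → Set) {n} xs (ys : Subset (n * m)) → P xs → (∀ i → P (block ys i)) →
    ∀ i → P (block {suc n} (xs ++ ys) i)
  blocks-∷ P {n} xs ys Pxs Pys zero    = subst P (sym (block-++-zero {n} xs ys)) Pxs
  blocks-∷ P {n} xs ys Pxs Pys (suc i) = subst P (sym (block-++-suc {n} xs ys i)) (Pys i)

  blocks-head : ∀ (P : Subset m → Set) {n} xs (ys : Subset (n * m)) → (∀ i → P (block {suc n} (xs ++ ys) i)) → P xs
  blocks-head P {n} xs ys Ps = subst P (block-++-zero {n} xs ys) (Ps zero)

  blocks-tail : ∀ (P : Subset m → Set) {n} xs (ys : Subset (n * m)) → (∀ i → P (block {suc n} (xs ++ ys) i)) →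
    ∀ (i : Fin n) → P (block ys i)
  blocks-tail P {n} xs ys Ps i = subst P (block-++-suc {n} xs ys i) (Ps (suc i))

  allBlocks-block : ∀ {Q : Subset m → Set} n {S} → AllBlocks Q n S → ∀ (i : Fin n) → Q (block S i)
  allBlocks-block {Q} (suc n) (xs , ys , refl , Qxs , Qys) = blocks-∷ Q xs ys Qxs (allBlocks-block n Qys)

  oneBlock-block : ∀ {Q R : Subset m → Set} n {S} → OneBlock Q R n S → ∀ (i : Fin n) → Q (block S i) ⊎ R (block S i)
  oneBlock-block {Q} {R} (suc n) (inj₁ (xs , ys , refl , Rxs , Qys)) =
    blocks-∷ (λ zs → Q zs ⊎ R zs) xs ys (inj₂ Rxs) (inj₁ ∘ allBlocks-block n Qys)
  oneBlock-block {Q} {R} (suc n) (inj₂ (xs , ys , refl , Qxs , ys∈)) =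
    blocks-∷ (λ zs → Q zs ⊎ R zs) xs ys (inj₁ Qxs) (oneBlock-block n ys∈)

  oneBlock-∃ : ∀ {Q R : Subset m → Set} n {S} → OneBlock Q R n S → ∃ λ (i : Fin n) → R (block S i)
  oneBlock-∃ {R = R} (suc n) (inj₁ (xs , ys , refl , Rxs , _))  = zero , subst R (sym (block-++-zero {n} xs ys)) Rxs
  oneBlock-∃ {R = R} (suc n) (inj₂ (xs , ys , refl , _ , ys∈)) =
    let i , Ri = oneBlock-∃ n ys∈ in suc i , subst R (sym (block-++-suc {n} xs ys i)) Ri

  ∣∣-AllBlocks : ∀ {Q : Subset m → Set} {c} → (∀ xs → Q xs → ∣ xs ∣ ≡ c) → ∀ n {S} → AllBlocks Q n S → ∣ S ∣ ≡ c * n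
  ∣∣-AllBlocks {c = c} size zero    refl = sym (*-zeroʳ c)
  ∣∣-AllBlocks {c = c} size (suc n) (xs , ys , refl , Qxs , Qys) = begin
    ∣ xs ++ ys ∣       ≡⟨ ∣++∣ xs ys ⟩
    ∣ xs ∣ + ∣ ys ∣    ≡⟨ cong₂ _+_ (size xs Qxs) (∣∣-AllBlocks size n Qys) ⟩
    c + c * n          ≡⟨ *-suc c n ⟨
    c * suc n          ∎
    where open ≡-Reasoning

  ∣∣-OneBlock : ∀ {Q R : Subset m → Set} {c} → (∀ xs → Q xs → ∣ xs ∣ ≡ c) → (∀ xs → R xs → ∣ xs ∣ ≡ suc c) →
    ∀ n {S} → OneBlock Q R n S → ∣ S ∣ ≡ c * n + 1
  ∣∣-OneBlock {c = c} sizeQ sizeR (suc n) (inj₁ (xs , ys , refl , Rxs , Qys)) = begin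
    ∣ xs ++ ys ∣        ≡⟨ ∣++∣ xs ys ⟩
    ∣ xs ∣ + ∣ ys ∣     ≡⟨ cong₂ _+_ (sizeR xs Rxs) (∣∣-AllBlocks sizeQ n Qys) ⟩
    suc c + c * n       ≡⟨ cong suc (*-suc c n) ⟨
    suc (c * suc n)     ≡⟨ +-comm 1 (c * suc n) ⟩
    c * suc n + 1       ∎
    where open ≡-Reasoning
  ∣∣-OneBlock {c = c} sizeQ sizeR (suc n) (inj₂ (xs , ys , refl , Qxs , ys∈)) = begin
    ∣ xs ++ ys ∣        ≡⟨ ∣++∣ xs ys ⟩
    ∣ xs ∣ + ∣ ys ∣     ≡⟨ cong₂ _+_ (sizeQ xs Qxs) (∣∣-OneBlock sizeQ sizeR n ys∈) ⟩
    c + (c * n + 1)     ≡⟨ +-assoc c (c * n) 1 ⟨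
    c + c * n + 1       ≡⟨ cong (_+ 1) (*-suc c n) ⟨
    c * suc n + 1       ∎
    where open ≡-Reasoning

  module _ {c} (B : Subset m → Set) (B⇒c≤ : ∀ xs → B xs → c ≤ ∣ xs ∣) where

    ∣∣-lower : ∀ n (S : Subset (n * m)) → (∀ (i : Fin n) → B (block S i)) → c * n ≤ ∣ S ∣
    ∣∣-lower zero    [] Bs = ≤-reflexive (*-zeroʳ c)
    ∣∣-lower (suc n) S Bs with xs , ys , refl ← splitAt m S = begin
      c * suc n          ≡⟨ *-suc c n ⟩
      c + c * n          ≤⟨ +-mono-≤ (B⇒c≤ xs (blocks-head B xs ys Bs)) (∣∣-lower n ys (blocks-tail B xs ys Bs)) ⟩
      ∣ xs ∣ + ∣ ys ∣    ≡⟨ ∣++∣ xs ys ⟨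
      ∣ xs ++ ys ∣       ∎
      where open ≤-Reasoning

    tight-AllBlocks : ∀ n (S : Subset (n * m)) → (∀ (i : Fin n) → B (block S i)) → ∣ S ∣ ≡ c * n →
      AllBlocks (λ xs → B xs × ∣ xs ∣ ≡ c) n S
    tight-AllBlocks zero    [] Bs size = refl
    tight-AllBlocks (suc n) S  Bs size with xs , ys , refl ← splitAt m S
      with ∣xs∣≡c , ∣ys∣≡cn ← tight-+ (B⇒c≤ xs (blocks-head B xs ys Bs)) (∣∣-lower n ys (blocks-tail B xs ys Bs))
                                      (trans (sym (∣++∣ xs ys)) (trans size (*-suc c n))) =
      xs , ys , refl , (blocks-head B xs ys Bs , ∣xs∣≡c) , tight-AllBlocks n ys (blocks-tail B xs ys Bs) ∣ys∣≡cn

    tight-OneBlock : ∀ n (S : Subset (n * m)) → (∀ (i : Fin n) → B (block S i)) → ∣ S ∣ ≡ c * n + 1 →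
      OneBlock (λ xs → B xs × ∣ xs ∣ ≡ c) (λ xs → ∣ xs ∣ ≡ suc c) n S
    tight-OneBlock zero    [] Bs size = contradiction (trans size (cong (_+ 1) (*-zeroʳ c))) λ ()
    tight-OneBlock (suc n) S  Bs size with xs , ys , refl ← splitAt m S
      with tight-+-suc (B⇒c≤ xs (blocks-head B xs ys Bs)) (∣∣-lower n ys (blocks-tail B xs ys Bs))
                       (trans (sym (∣++∣ xs ys)) (trans size (trans (+-comm _ 1) (cong suc (*-suc c n)))))
    ... | inj₁ (∣xs∣≡1+c , ∣ys∣≡cn) = inj₁ (xs , ys , refl , ∣xs∣≡1+c ,
                                           tight-AllBlocks n ys (blocks-tail B xs ys Bs) ∣ys∣≡cn)
    ... | inj₂ (∣xs∣≡c , ∣ys∣≡1+cn) = inj₂ (xs , ys , refl , (blocks-head B xs ys Bs , ∣xs∣≡c) ,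
                                           tight-OneBlock n ys (blocks-tail B xs ys Bs) (trans ∣ys∣≡1+cn (+-comm 1 (c * n))))

count-∧ : ∀ {m} c (f : Fin m → Bool) → count (λ b → c ∧ f b) ≡ (if c then count f else 0)
count-∧ true  f = refl
count-∧ false f = count-false (λ b → false ∧ f b) (λ _ → refl)

module Corona (n p : ℕ) where

  G : Graph (n * suc p)
  G = corona n p

  hub : Fin n → Fin (n * suc p)
  hub i = combine i zero

  leaf : Fin n → Fin p → Fin (n * suc p)
  leaf i a = combine i (suc a)

  leavesIn : Subset (n * suc p) → Fin n → ℕ
  leavesIn S i = count (lookup S ∘ leaf i)

  vertex-elim : (P : Fin (n * suc p) → Set) → (∀ i → P (hub i)) → (∀ i a → P (leaf i a)) → ∀ x → P x
  vertex-elim P P-hub P-leaf x = subst P (combine-remQuot {n} (suc p) x) (by-block (remQuot (suc p) x))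
    where
    by-block : ∀ ia → P (combine (proj₁ ia) (proj₂ ia))
    by-block (i , zero)  = P-hub i
    by-block (i , suc a) = P-leaf i a

  onBlocks : (Fin n → Fin (suc p) → Bool) → Subset (n * suc p)
  onBlocks f = tabulate (λ x → uncurry f (remQuot (suc p) x))

  lookup-onBlocks : ∀ f i a → lookup (onBlocks f) (combine i a) ≡ f i a
  lookup-onBlocks f i a = trans (lookup∘tabulate _ (combine i a)) (cong (uncurry f) (remQuot-combine i a))

  nbrsIn-combine : ∀ T i a →
    nbrsIn G T (combine i a) ≡ ∑[ j < n ] count (λ b → coronaAdj' n p (i , a) (j , b) ∧ lookup T (combine j b))
  nbrsIn-combine T i a = trans (count-combine n _) (sum-cong-≗ λ j → count-cong λ b →
    cong (_∧ lookup T (combine j b)) (cong₂ (coronaAdj' n p) (remQuot-combine i a) (remQuot-combine j b)))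

  nbrsIn-hub : ∀ T i →
    nbrsIn G T (hub i) ≡ count (λ j → cycAdj n i j ∧ lookup T (hub j)) + leavesIn T i
  nbrsIn-hub T i = begin
    nbrsIn G T (hub i)
      ≡⟨ nbrsIn-combine T i zero ⟩
    ∑[ j < n ] count (λ b → coronaAdj' n p (i , zero) (j , b) ∧ lookup T (combine j b))
      ≡⟨ sum-cong-≗ (λ j → trans (count-suc (λ b → coronaAdj' n p (i , zero) (j , b) ∧ lookup T (combine j b)))
                                (cong (bit (cycAdj n i j ∧ lookup T (hub j)) +_) (count-∧ (sameFin i j) (lookup T ∘ leaf j)))) ⟩
    ∑[ j < n ] (bit (cycAdj n i j ∧ lookup T (hub j)) + (if sameFin i j then leavesIn T j else 0))
      ≡⟨ ∑-distrib-+ (λ j → bit (cycAdj n i j ∧ lookup T (hub j))) (λ j → if sameFin i j then leavesIn T j else 0) ⟩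
    ∑[ j < n ] bit (cycAdj n i j ∧ lookup T (hub j)) + ∑[ j < n ] (if sameFin i j then leavesIn T j else 0)
      ≡⟨ cong₂ _+_ (sum-bit (λ j → cycAdj n i j ∧ lookup T (hub j))) (sum-sameFin i (leavesIn T)) ⟩
    count (λ j → cycAdj n i j ∧ lookup T (hub j)) + leavesIn T i
      ∎
    where open ≡-Reasoning

  nbrsIn-leaf : ∀ T i a →
    nbrsIn G T (leaf i a) + bit (lookup T (leaf i a)) ≡ bit (lookup T (hub i)) + leavesIn T i
  nbrsIn-leaf T i a = begin
    nbrsIn G T (leaf i a) + bit (lookup T (leaf i a))               ≡⟨ cong (_+ bit (lookup T (leaf i a))) leaf-nbrs ⟩
    (bit (lookup T (hub i)) + others) + bit (lookup T (leaf i a))   ≡⟨ xy∙z≈x∙zy (bit (lookup T (hub i))) others _ ⟩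
    bit (lookup T (hub i)) + (bit (lookup T (leaf i a)) + others)   ≡⟨ cong (bit (lookup T (hub i)) +_) (count-remove _ a) ⟨
    bit (lookup T (hub i)) + leavesIn T i                           ∎
    where
    open ≡-Reasoning
    others : ℕ
    others = count (λ b → a ≢ᵇ b ∧ lookup T (leaf i b))

    blockCount : ∀ c j → bit (c ∧ lookup T (hub j)) + count (λ b → (c ∧ a ≢ᵇ b) ∧ lookup T (leaf j b))
                       ≡ (if c then bit (lookup T (hub j)) + count (λ b → a ≢ᵇ b ∧ lookup T (leaf j b)) else 0)
    blockCount true  j = refl
    blockCount false j = count-false (λ b → false ∧ lookup T (leaf j b)) (λ _ → refl)

    leaf-nbrs : nbrsIn G T (leaf i a) ≡ bit (lookup T (hub i)) + others
    leaf-nbrs = begin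
      nbrsIn G T (leaf i a)
        ≡⟨ nbrsIn-combine T i (suc a) ⟩
      ∑[ j < n ] count (λ b → coronaAdj' n p (i , suc a) (j , b) ∧ lookup T (combine j b))
        ≡⟨ sum-cong-≗ (λ j → trans (count-suc (λ b → coronaAdj' n p (i , suc a) (j , b) ∧ lookup T (combine j b)))
                                  (blockCount (sameFin i j) j)) ⟩
      ∑[ j < n ] (if sameFin i j then bit (lookup T (hub j)) + count (λ b → a ≢ᵇ b ∧ lookup T (leaf j b)) else 0)
        ≡⟨ sum-sameFin i (λ j → bit (lookup T (hub j)) + count (λ b → a ≢ᵇ b ∧ lookup T (leaf j b))) ⟩
      bit (lookup T (hub i)) + others
        ∎

  ∣∣-blocks : ∀ S → ∣ S ∣ ≡ ∑[ i < n ] (bit (lookup S (hub i)) + leavesIn S i)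
  ∣∣-blocks S = begin
    ∣ S ∣                                                    ≡⟨ ∣∣≡count S ⟩
    count (lookup S)                                         ≡⟨ count-combine n (lookup S) ⟩
    ∑[ i < n ] count (lookup S ∘ combine i)                  ≡⟨ sum-cong-≗ {n} (λ i → count-suc (lookup S ∘ combine i)) ⟩
    ∑[ i < n ] (bit (lookup S (hub i)) + leavesIn S i)       ∎
    where open ≡-Reasoning

SizedConversionSet : ∀ n p → ℕ → ℕ → Subset (n * suc p) → Set
SizedConversionSet n p k c S = ∣ S ∣ ≡ c × IsConversionSet (corona n p) k S

-- Thresholds k ≤ p + 1

module LowThreshold (n p K : ℕ) where
  open Corona n p

  module _ (S : Subset (n * suc p)) (K≤leaves : ∀ i → K ≤ leavesIn S i) where

    private
      P : ℕ → Subset (n * suc p)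
      P = process G (suc K) S

      k≤1+leaves : ∀ t i → suc K ≤ suc (leavesIn (P t) i)
      k≤1+leaves t i = s≤s (≤-trans (K≤leaves i) (count-mono (λ a → S⊆process G (suc K) S t (leaf i a))))

    seed-coloured : ∀ i → lookup S (hub i) ≡ true ⊎ suc K ≤ leavesIn S i → EventuallyColoured G (suc K) S (hub i)
    seed-coloured i (inj₁ S-hub)    = 0 , S-hub
    seed-coloured i (inj₂ k≤leaves) = coloured-by-threshold G (suc K) S 0 (hub i) (begin
      suc K                                                       ≤⟨ k≤leaves ⟩
      leavesIn S i                                                ≤⟨ m≤n+m _ _ ⟩
      count (λ j → cycAdj n i j ∧ lookup S (hub j)) + leavesIn S i ≡⟨ nbrsIn-hub S i ⟨
      nbrsIn G S (hub i)                                          ∎)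
      where open ≤-Reasoning

    hub-spreads : ∀ i j → cycSucc n i j ≡ true →
      EventuallyColoured G (suc K) S (hub i) → EventuallyColoured G (suc K) S (hub j)
    hub-spreads i j succ (t , Pt-hub) = coloured-by-threshold G (suc K) S t (hub j) (begin
      suc K                                                                 ≤⟨ k≤1+leaves t j ⟩
      1 + leavesIn (P t) j                                                  ≤⟨ +-monoˡ-≤ _ (count≥1 _ {i} edge) ⟩
      count (λ l → cycAdj n j l ∧ lookup (P t) (hub l)) + leavesIn (P t) j   ≡⟨ nbrsIn-hub (P t) j ⟨
      nbrsIn G (P t) (hub j)                                                ∎)
      where
      open ≤-Reasoning
      edge : cycAdj n j i ∧ lookup (P t) (hub i) ≡ true
      edge = cong₂ _∧_ (trans (cycAdj-sym n j i) (cycSucc⇒cycAdj n i j succ)) Pt-hub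

    leaf-follows-hub : ∀ i a → EventuallyColoured G (suc K) S (hub i) → EventuallyColoured G (suc K) S (leaf i a)
    leaf-follows-hub i a (t , Pt-hub) with lookup (P t) (leaf i a) in Pt-leaf
    ... | true  = t , Pt-leaf
    ... | false = coloured-by-threshold G (suc K) S t (leaf i a) (begin
      suc K                                                        ≤⟨ k≤1+leaves t i ⟩
      suc (leavesIn (P t) i)                                       ≡⟨ cong (λ b → bit b + leavesIn (P t) i) Pt-hub ⟨
      bit (lookup (P t) (hub i)) + leavesIn (P t) i                ≡⟨ nbrsIn-leaf (P t) i a ⟨
      nbrsIn G (P t) (leaf i a) + bit (lookup (P t) (leaf i a))    ≡⟨ cong (λ b → nbrsIn G (P t) (leaf i a) + bit b) Pt-leaf ⟩
      nbrsIn G (P t) (leaf i a) + 0                                ≡⟨ +-identityʳ _ ⟩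
      nbrsIn G (P t) (leaf i a)                                    ∎)
      where open ≤-Reasoning

    leaves-conversion : (∃ λ i₀ → lookup S (hub i₀) ≡ true ⊎ suc K ≤ leavesIn S i₀) → IsConversionSet G (suc K) S
    leaves-conversion (i₀ , seed) = eventually-coloured⇒conversion G (suc K) S
      (vertex-elim (EventuallyColoured G (suc K) S) hub-coloured (λ i a → leaf-follows-hub i a (hub-coloured i)))
      where
      hub-coloured : ∀ i → EventuallyColoured G (suc K) S (hub i)
      hub-coloured = cycle-connected (EventuallyColoured G (suc K) S ∘ hub) hub-spreads (seed-coloured i₀ seed)

  outsideLeavesOf : Fin n → Fin n → Fin (suc p) → Bool
  outsideLeavesOf i j zero    = true
  outsideLeavesOf i j (suc _) = i ≢ᵇ j

  -- Colour everything except the uncoloured leaves of a block i with fewer than K coloured leaves: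
  -- each of those sees at most K coloured vertices, so the process never leaves this set.
  conversion⇒leaves : K ≤ p → ∀ S → IsConversionSet G (suc K) S → ∀ i → K ≤ leavesIn S i
  conversion⇒leaves K≤p S conversion i with K ≤? leavesIn S i
  ... | yes K≤leaves = K≤leaves
  ... | no  K≰leaves = contradiction conversion
    (closed⇒¬conversion G (suc K) {S} {T} (⊆ᵇ-∪ˡ S U) (vertex-elim _ hub-case leaf-case) (leaf i a₀) T-leaf-a₀)
    where
    few : leavesIn S i < K
    few = ≰⇒> K≰leaves
    U : Subset (n * suc p)
    U = onBlocks (outsideLeavesOf i)
    T : Subset (n * suc p)
    T = S ∪ U

    lookup-T : ∀ j b → lookup T (combine j b) ≡ lookup S (combine j b) ∨ outsideLeavesOf i j b
    lookup-T j b = trans (lookup-∪ S U (combine j b)) (cong (lookup S (combine j b) ∨_) (lookup-onBlocks _ j b))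

    T-leaf≡S-leaf : ∀ a → lookup T (leaf i a) ≡ lookup S (leaf i a)
    T-leaf≡S-leaf a = trans (lookup-T i (suc a)) (trans (cong (lookup S (leaf i a) ∨_) (≢ᵇ-irrefl i)) (∨-identityʳ _))

    leaves-T : leavesIn T i ≡ leavesIn S i
    leaves-T = count-cong T-leaf≡S-leaf

    uncoloured : ∃ λ a → lookup S (leaf i a) ≡ false
    uncoloured = count<⇒false (lookup S ∘ leaf i) (<-≤-trans few K≤p)
    a₀ : Fin p
    a₀ = proj₁ uncoloured

    T-leaf-a₀ : lookup T (leaf i a₀) ≡ false
    T-leaf-a₀ = trans (T-leaf≡S-leaf a₀) (proj₂ uncoloured)

    hub-case : ∀ j → lookup T (hub j) ≡ false → nbrsIn G T (hub j) < suc K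
    hub-case j T-hub = contradiction (trans (sym T-hub) (trans (lookup-T j zero) (∨-zeroʳ _))) λ ()

    leaf-case : ∀ j b → lookup T (leaf j b) ≡ false → nbrsIn G T (leaf j b) < suc K
    leaf-case j b T-leaf with refl ← ≢ᵇ-false⇒≡ i j (∨-conicalʳ _ _ (trans (sym (lookup-T j (suc b))) T-leaf)) = begin-strict
      nbrsIn G T (leaf i b)                               ≤⟨ m≤m+n _ _ ⟩
      nbrsIn G T (leaf i b) + bit (lookup T (leaf i b))   ≡⟨ nbrsIn-leaf T i b ⟩
      bit (lookup T (hub i)) + leavesIn T i               ≤⟨ +-mono-≤ (bit≤1 _) (≤-reflexive leaves-T) ⟩
      1 + leavesIn S i                                    <⟨ s≤s few ⟩
      suc K                                               ∎
      where open ≤-Reasoning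

  -- A block of a subset is its hub followed by its leaves: ∣ tail (block S i) ∣ is leavesIn S i.
  Quiet : Subset (suc p) → Set
  Quiet xs = K ≤ ∣ tail xs ∣ × ∣ xs ∣ ≡ K

  Seed : Subset (suc p) → Set
  Seed xs = ∣ xs ∣ ≡ suc K

  K≤leaves⇒K≤∣∣ : ∀ (xs : Subset (suc p)) → K ≤ ∣ tail xs ∣ → K ≤ ∣ xs ∣
  K≤leaves⇒K≤∣∣ (x ∷ t) K≤∣t∣ = ≤-trans K≤∣t∣ (≤-trans (m≤n+m ∣ t ∣ (bit x)) (≤-reflexive (sym (∣∷∣ x t))))

  seed-leaves : ∀ (xs : Subset (suc p)) → Seed xs → K ≤ ∣ tail xs ∣
  seed-leaves (x ∷ t) seed = s≤s⁻¹ (begin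
    suc K             ≡⟨ seed ⟨
    ∣ x ∷ t ∣         ≡⟨ ∣∷∣ x t ⟩
    bit x + ∣ t ∣     ≤⟨ +-monoˡ-≤ ∣ t ∣ (bit≤1 x) ⟩
    suc ∣ t ∣         ∎)
    where open ≤-Reasoning

  seed-ignites : ∀ (xs : Subset (suc p)) → Seed xs → head xs ≡ true ⊎ suc K ≤ ∣ tail xs ∣
  seed-ignites (true  ∷ t) seed = inj₁ refl
  seed-ignites (false ∷ t) seed = inj₂ (≤-reflexive (sym seed))

  quiet-seed-disjoint : ∀ (xs : Subset (suc p)) → Quiet xs → Seed xs → ⊥
  quiet-seed-disjoint xs (_ , ∣xs∣≡K) ∣xs∣≡1+K = 1+n≢n (trans (sym ∣xs∣≡1+K) ∣xs∣≡K)

  numberOf-Quiet : NumberOf Quiet (p C K)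
  numberOf-Quiet = numberOf-⇔ hubless⇔quiet (numberOf-image (false ∷_) (cong tail) (numberOf-size p K))
    where
    hubless⇔quiet : ∀ xs → (∃ λ t → ∣ t ∣ ≡ K × xs ≡ false ∷ t) ⇔ Quiet xs
    hubless⇔quiet xs = mk⇔ (λ { (t , ∣t∣≡K , refl) → ≤-reflexive (sym ∣t∣≡K) , ∣t∣≡K }) (from′ xs)
      where
      from′ : ∀ xs → Quiet xs → ∃ λ t → ∣ t ∣ ≡ K × xs ≡ false ∷ t
      from′ (false ∷ t) (_ , ∣t∣≡K)     = t , ∣t∣≡K , refl
      from′ (true  ∷ t) (K≤∣t∣ , 1+∣t∣≡K) = contradiction (≤-trans (≤-reflexive 1+∣t∣≡K) K≤∣t∣) 1+n≰n

  oneSeed⇔conversion : K ≤ p → ∀ S → OneBlock Quiet Seed n S ⇔ SizedConversionSet n p (suc K) (K * n + 1) S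
  oneSeed⇔conversion K≤p S = mk⇔
    (λ oneSeed → ∣∣-OneBlock (λ _ → proj₂) (λ _ seed → seed) n oneSeed ,
                 leaves-conversion S (K≤leaves oneSeed) (ignition oneSeed))
    (λ (size , conversion) → tight-OneBlock (λ xs → K ≤ ∣ tail xs ∣) K≤leaves⇒K≤∣∣ n S
                               (conversion⇒leaves K≤p S conversion) size)
    where
    K≤leaves : OneBlock Quiet Seed n S → ∀ i → K ≤ leavesIn S i
    K≤leaves oneSeed i = [ proj₁ , seed-leaves (block S i) ] (oneBlock-block n oneSeed i)
    ignition : OneBlock Quiet Seed n S → ∃ λ i₀ → lookup S (hub i₀) ≡ true ⊎ suc K ≤ leavesIn S i₀
    ignition oneSeed = let i₀ , seed = oneBlock-∃ n oneSeed in i₀ , seed-ignites (block S i₀) seed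

  numberOf-lowThreshold : K ≤ p →
    NumberOf (SizedConversionSet n p (suc K) (K * n + 1)) (n * (p C K) ^ (n ∸ 1) * (suc p C suc K))
  numberOf-lowThreshold K≤p = numberOf-⇔ (oneSeed⇔conversion K≤p)
    (numberOf-OneBlock quiet-seed-disjoint numberOf-Quiet (numberOf-size (suc p) (suc K)) n)

-- Minimum vertex covers of the cycle C_n

double : ℕ → ℕ
double zero    = zero
double (suc m) = suc (suc (double m))

double-injective : ∀ {a b} → double a ≡ double b → a ≡ b
double-injective {zero}  {zero}  _  = refl
double-injective {suc a} {suc b} eq = cong suc (double-injective (suc-injective (suc-injective eq)))

double≢1+double : ∀ a b → double a ≢ suc (double b)
double≢1+double (suc a) (suc b) eq = double≢1+double a b (suc-injective (suc-injective eq))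

parity : ∀ n → ∃ λ m → n ≡ double m ⊎ n ≡ suc (double m)
parity zero = 0 , inj₁ refl
parity (suc n) with parity n
... | m , inj₁ refl = m , inj₂ refl
... | m , inj₂ refl = suc m , inj₁ refl

⌈double/2⌉ : ∀ m → ⌈ double m /2⌉ ≡ m
⌈double/2⌉ zero    = refl
⌈double/2⌉ (suc m) = cong suc (⌈double/2⌉ m)

⌈1+double/2⌉ : ∀ m → ⌈ suc (double m) /2⌉ ≡ suc m
⌈1+double/2⌉ zero    = refl
⌈1+double/2⌉ (suc m) = cong suc (⌈1+double/2⌉ m)

double%2 : ∀ m → double m % 2 ≡ 0
double%2 zero    = refl
double%2 (suc m) = double%2 m

1+double%2 : ∀ m → suc (double m) % 2 ≡ 1
1+double%2 zero    = refl
1+double%2 (suc m) = 1+double%2 m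

PathCover : ∀ {L} → Vec Bool (suc L) → Set
PathCover {zero}  (x ∷ [])    = Unit.⊤
PathCover {suc L} (x ∷ y ∷ s) = x ∨ y ≡ true × PathCover (y ∷ s)

CycleCover : ∀ {L} → Vec Bool (suc L) → Set
CycleCover s = PathCover s × last s ∨ head s ≡ true

coveredTwice : ∀ {L} → Vec Bool (suc L) → ℕ
coveredTwice {zero}  (x ∷ [])    = 0
coveredTwice {suc L} (x ∷ y ∷ s) = bit (x ∧ y) + coveredTwice (y ∷ s)

excess : ∀ {L} → Vec Bool (suc L) → ℕ
excess s = bit (head s) + bit (last s) + coveredTwice s

-- Double counting: each of the L edges of the path has one or two ends in s, and every vertex
-- of s except the two end vertices of the path lies on two edges.
double-∣∣ : ∀ {L} (s : Vec Bool (suc L)) → PathCover s → double ∣ s ∣ ≡ L + excess s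
double-∣∣ {zero}  (true  ∷ [])        _       = refl
double-∣∣ {zero}  (false ∷ [])        _       = refl
double-∣∣ {suc L} (true  ∷ true  ∷ s) (_ , c) =
  trans (cong (2 +_) (double-∣∣ (true ∷ s) c)) (both L (bit (last (true ∷ s))) (coveredTwice (true ∷ s)))
  where
  both : ∀ L ℓ t → 2 + (L + (1 + ℓ + t)) ≡ suc L + (1 + ℓ + (1 + t))
  both = solve-∀
double-∣∣ {suc L} (true  ∷ false ∷ s) (_ , c) =
  trans (cong (2 +_) (double-∣∣ (false ∷ s) c)) (first L (bit (last (false ∷ s))) (coveredTwice (false ∷ s)))
  where
  first : ∀ L ℓ t → 2 + (L + (0 + ℓ + t)) ≡ suc L + (1 + ℓ + (0 + t))
  first = solve-∀
double-∣∣ {suc L} (false ∷ true  ∷ s) (_ , c) =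
  trans (double-∣∣ (true ∷ s) c) (second L (bit (last (true ∷ s))) (coveredTwice (true ∷ s)))
  where
  second : ∀ L ℓ t → L + (1 + ℓ + t) ≡ suc L + (0 + ℓ + (0 + t))
  second = solve-∀

alternating : Bool → ∀ m → Vec Bool m
alternating b zero    = []
alternating b (suc m) = b ∷ alternating (not b) m

alternating-cover : ∀ b L → PathCover (alternating b (suc L))
alternating-cover b     zero    = Unit.tt
alternating-cover true  (suc L) = refl , alternating-cover false L
alternating-cover false (suc L) = refl , alternating-cover true L

alternating-coveredTwice : ∀ b L → coveredTwice (alternating b (suc L)) ≡ 0
alternating-coveredTwice b     zero    = refl
alternating-coveredTwice true  (suc L) = alternating-coveredTwice false L
alternating-coveredTwice false (suc L) = alternating-coveredTwice true L

last-alternating-odd : ∀ b m → last (alternating b (suc (double m))) ≡ b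
last-alternating-odd b zero    = refl
last-alternating-odd b (suc m) = trans (last-alternating-odd (not (not b)) m) (not-involutive b)

last-alternating-even : ∀ b m → last (alternating b (double (suc m))) ≡ not b
last-alternating-even b zero    = refl
last-alternating-even b (suc m) = trans (last-alternating-even (not (not b)) m) (cong not (not-involutive b))

coveredTwice≡0⇒alternating : ∀ {L} (s : Vec Bool (suc L)) → PathCover s → coveredTwice s ≡ 0 →
  s ≡ alternating (head s) (suc L)
coveredTwice≡0⇒alternating (x ∷ [])            _        _  = refl
coveredTwice≡0⇒alternating (true  ∷ false ∷ s) (_ , c)  t≡0 = cong (true ∷_) (coveredTwice≡0⇒alternating (false ∷ s) c t≡0)
coveredTwice≡0⇒alternating (false ∷ true  ∷ s) (_ , c)  t≡0 = cong (false ∷_) (coveredTwice≡0⇒alternating (true ∷ s) c t≡0)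
coveredTwice≡0⇒alternating (false ∷ false ∷ s) (() , _) _

OneDoubleEdge : ∀ {L} → Vec Bool (suc L) → Set
OneDoubleEdge s = PathCover s × coveredTwice s ≡ 1

numberOf-OneDoubleEdge : ∀ L → NumberOf {suc L} OneDoubleEdge L
numberOf-OneDoubleEdge zero    = numberOf-∅ λ { (x ∷ []) (_ , ()) }
numberOf-OneDoubleEdge (suc L) = numberOf-⇔ split
  (numberOf-⊎ disjoint (numberOf-singleton (true ∷ alternating true (suc L)))
                       (numberOf-image prependCover (cong tail) (numberOf-OneDoubleEdge L)))
  where
  prependCover : Vec Bool (suc L) → Vec Bool (suc (suc L))
  prependCover s = not (head s) ∷ s

  disjoint : ∀ s → s ≡ true ∷ alternating true (suc L) → (∃ λ r → OneDoubleEdge r × s ≡ prependCover r) → ⊥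
  disjoint s refl (true  ∷ r , _ , ())
  disjoint s refl (false ∷ r , _ , ())

  split : ∀ s → (s ≡ true ∷ alternating true (suc L) ⊎ ∃ λ r → OneDoubleEdge r × s ≡ prependCover r) ⇔ OneDoubleEdge s
  split s = mk⇔ to′ (from′ s)
    where
    to′ : (s ≡ true ∷ alternating true (suc L) ⊎ ∃ λ r → OneDoubleEdge r × s ≡ prependCover r) → OneDoubleEdge s
    to′ (inj₁ refl) = (refl , alternating-cover true L) , cong suc (alternating-coveredTwice true L)
    to′ (inj₂ (true  ∷ r , (c , t≡1) , refl)) = (refl , c) , t≡1
    to′ (inj₂ (false ∷ r , (c , t≡1) , refl)) = (refl , c) , t≡1
    from′ : ∀ s → OneDoubleEdge s → s ≡ true ∷ alternating true (suc L) ⊎ ∃ λ r → OneDoubleEdge r × s ≡ prependCover r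
    from′ (true  ∷ true  ∷ r) ((_ , c) , t≡1) =
      inj₁ (cong (true ∷_) (coveredTwice≡0⇒alternating (true ∷ r) c (suc-injective t≡1)))
    from′ (true  ∷ false ∷ r) ((_ , c) , t≡1) = inj₂ (false ∷ r , (c , t≡1) , refl)
    from′ (false ∷ true  ∷ r) ((_ , c) , t≡1) = inj₂ (true ∷ r , (c , t≡1) , refl)
    from′ (false ∷ false ∷ r) ((() , _) , _)

bit-not : ∀ b → bit b + bit (not b) ≡ 1
bit-not true  = refl
bit-not false = refl

alternating-minCover-even : ∀ m b →
  CycleCover (alternating b (double (suc m))) × ∣ alternating b (double (suc m)) ∣ ≡ suc m
alternating-minCover-even m b = (cover , trans (cong (_∨ b) (last-alternating-even b m)) (∨-inverseˡ b)) ,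
  double-injective (begin
    double ∣ s ∣
      ≡⟨ double-∣∣ s cover ⟩
    suc D + (bit b + bit (last s) + coveredTwice s)
      ≡⟨ cong₂ (λ ℓ t → suc D + (bit b + bit ℓ + t)) (last-alternating-even b m) (alternating-coveredTwice b (suc D)) ⟩
    suc D + (bit b + bit (not b) + 0)
      ≡⟨ cong (λ e → suc D + (e + 0)) (bit-not b) ⟩
    suc D + 1
      ≡⟨ +-comm (suc D) 1 ⟩
    double (suc m)
      ∎)
  where
  open ≡-Reasoning
  D : ℕ
  D = double m
  s : Vec Bool (double (suc m))
  s = alternating b (suc (suc D))
  cover : PathCover s
  cover = alternating-cover b (suc D)

alternating-minCover-odd : ∀ m →
  CycleCover (alternating true (suc (double m))) × ∣ alternating true (suc (double m)) ∣ ≡ suc m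
alternating-minCover-odd m = (cover , cong (_∨ true) (last-alternating-odd true m)) ,
  double-injective (begin
    double ∣ s ∣
      ≡⟨ double-∣∣ s cover ⟩
    D + (1 + bit (last s) + coveredTwice s)
      ≡⟨ cong₂ (λ ℓ t → D + (1 + bit ℓ + t)) (last-alternating-odd true m) (alternating-coveredTwice true D) ⟩
    D + 2
      ≡⟨ +-comm D 2 ⟩
    double (suc m)
      ∎)
  where
  open ≡-Reasoning
  D : ℕ
  D = double m
  s : Vec Bool (suc (double m))
  s = alternating true (suc D)
  cover : PathCover s
  cover = alternating-cover true D

oneDoubleEdge-minCover : ∀ m (s : Vec Bool (suc (double m))) → OneDoubleEdge s → CycleCover s × ∣ s ∣ ≡ suc m
oneDoubleEdge-minCover m s (c , t≡1) = by-ends (head s) (last s) refl refl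
  where
  D : ℕ
  D = double m
  size : ∀ h ℓ → head s ≡ h → last s ≡ ℓ → double ∣ s ∣ ≡ D + (bit h + bit ℓ + 1)
  size h ℓ refl refl = trans (double-∣∣ s c) (cong (λ t → D + (bit h + bit ℓ + t)) t≡1)
  -- The two ends of the path cannot both lie in s or both outside s: then |s| would have the wrong parity.
  by-ends : ∀ h ℓ → head s ≡ h → last s ≡ ℓ → CycleCover s × ∣ s ∣ ≡ suc m
  by-ends true  true  h≡ ℓ≡ = contradiction (trans (size true true h≡ ℓ≡) (+-comm D 3)) (double≢1+double _ (suc m))
  by-ends false false h≡ ℓ≡ = contradiction (trans (size false false h≡ ℓ≡) (+-comm D 1)) (double≢1+double _ m)
  by-ends true  false h≡ ℓ≡ = (c , subst₂ (λ ℓ h → ℓ ∨ h ≡ true) (sym ℓ≡) (sym h≡) refl) ,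
    double-injective (trans (size true false h≡ ℓ≡) (+-comm D 2))
  by-ends false true  h≡ ℓ≡ = (c , subst₂ (λ ℓ h → ℓ ∨ h ≡ true) (sym ℓ≡) (sym h≡) refl) ,
    double-injective (trans (size false true h≡ ℓ≡) (+-comm D 2))

excess-even : ∀ m (s : Vec Bool (double (suc m))) → PathCover s → ∣ s ∣ ≡ suc m → excess s ≡ 1
excess-even m s c size = +-cancelˡ-≡ (suc (double m)) _ _ (begin
  suc (double m) + excess s   ≡⟨ double-∣∣ s c ⟨
  double ∣ s ∣                ≡⟨ cong double size ⟩
  suc (suc (double m))        ≡⟨ +-comm 1 (suc (double m)) ⟩
  suc (double m) + 1          ∎)
  where open ≡-Reasoning

excess-odd : ∀ m (s : Vec Bool (suc (double m))) → PathCover s → ∣ s ∣ ≡ suc m → excess s ≡ 2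
excess-odd m s c size = +-cancelˡ-≡ (double m) _ _ (begin
  double m + excess s         ≡⟨ double-∣∣ s c ⟨
  double ∣ s ∣                ≡⟨ cong double size ⟩
  suc (suc (double m))        ≡⟨ +-comm 2 (double m) ⟩
  double m + 2                ∎)
  where open ≡-Reasoning

minCycleCovers-even : ∀ m (s : Vec Bool (double (suc m))) →
  (CycleCover s × ∣ s ∣ ≡ suc m) ⇔ (s ≡ alternating true _ ⊎ s ≡ alternating false _)
minCycleCovers-even m s = mk⇔ to′ from′
  where
  no-double-edge : ∀ h ℓ t → ℓ ∨ h ≡ true → bit h + bit ℓ + t ≡ 1 → t ≡ 0
  no-double-edge true  false t _ e = suc-injective e
  no-double-edge false true  t _ e = suc-injective e

  to′ : CycleCover s × ∣ s ∣ ≡ suc m → s ≡ alternating true _ ⊎ s ≡ alternating false _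
  to′ ((c , wrap) , size) with head s
    | coveredTwice≡0⇒alternating s c (no-double-edge (head s) (last s) (coveredTwice s) wrap (excess-even m s c size))
  ... | true  | s≡alternating = inj₁ s≡alternating
  ... | false | s≡alternating = inj₂ s≡alternating

  from′ : s ≡ alternating true _ ⊎ s ≡ alternating false _ → CycleCover s × ∣ s ∣ ≡ suc m
  from′ (inj₁ refl) = alternating-minCover-even m true
  from′ (inj₂ refl) = alternating-minCover-even m false

minCycleCovers-odd : ∀ m (s : Vec Bool (suc (double m))) →
  (CycleCover s × ∣ s ∣ ≡ suc m) ⇔ (s ≡ alternating true _ ⊎ OneDoubleEdge s)
minCycleCovers-odd m s = mk⇔ to′ from′
  where
  to′ : CycleCover s × ∣ s ∣ ≡ suc m → s ≡ alternating true _ ⊎ OneDoubleEdge s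
  to′ ((c , wrap) , size) = by-ends (head s) (last s) refl refl wrap (excess-odd m s c size)
    where
    by-ends : ∀ h ℓ → head s ≡ h → last s ≡ ℓ → ℓ ∨ h ≡ true → bit h + bit ℓ + coveredTwice s ≡ 2 →
              s ≡ alternating true _ ⊎ OneDoubleEdge s
    by-ends true  true  h≡ _ _ e = inj₁ (trans (coveredTwice≡0⇒alternating s c (suc-injective (suc-injective e)))
                                               (cong (λ b → alternating b _) h≡))
    by-ends true  false _  _ _ e = inj₂ (c , suc-injective e)
    by-ends false true  _  _ _ e = inj₂ (c , suc-injective e)

  from′ : s ≡ alternating true _ ⊎ OneDoubleEdge s → CycleCover s × ∣ s ∣ ≡ suc m
  from′ (inj₁ refl)    = alternating-minCover-odd m
  from′ (inj₂ oneEdge) = oneDoubleEdge-minCover m s oneEdge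

CoversCycle : ∀ n → Vec Bool n → Set
CoversCycle n s = ∀ i j → cycSucc n i j ≡ true → lookup s i ∨ lookup s j ≡ true

pathCover⇔ : ∀ {L} (s : Vec Bool (suc L)) → PathCover s ⇔ (∀ (i : Fin L) → lookup s (inject₁ i) ∨ lookup s (suc i) ≡ true)
pathCover⇔ s = mk⇔ (to′ s) (from′ s)
  where
  to′ : ∀ {L} (s : Vec Bool (suc L)) → PathCover s → ∀ (i : Fin L) → lookup s (inject₁ i) ∨ lookup s (suc i) ≡ true
  to′ (x ∷ y ∷ s) (x∨y , c) zero    = x∨y
  to′ (x ∷ y ∷ s) (x∨y , c) (suc i) = to′ (y ∷ s) c i
  from′ : ∀ {L} (s : Vec Bool (suc L)) → (∀ (i : Fin L) → lookup s (inject₁ i) ∨ lookup s (suc i) ≡ true) → PathCover s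
  from′ (x ∷ [])    covered = Unit.tt
  from′ (x ∷ y ∷ s) covered = covered zero , from′ (y ∷ s) (covered ∘ suc)

lookup-fromℕ : ∀ {A : Set} {L} (s : Vec A (suc L)) → lookup s (fromℕ L) ≡ last s
lookup-fromℕ (x ∷ [])    = refl
lookup-fromℕ (x ∷ y ∷ s) = lookup-fromℕ (y ∷ s)

coversCycle⇔cycleCover : ∀ {L} (s : Vec Bool (suc L)) → CoversCycle (suc L) s ⇔ CycleCover s
coversCycle⇔cycleCover {L} s@(x ∷ _) = mk⇔
  (λ covers → from (pathCover⇔ s) (λ i → covers (inject₁ i) (suc i) (cycSucc-inject₁ i)) ,
              subst (λ ℓ → ℓ ∨ x ≡ true) (lookup-fromℕ s) (covers (fromℕ L) zero (cycSucc-fromℕ L)))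
  (λ (c , wrap) i j succ → edge c wrap i j (cycSucc-inv (suc L) i j succ))
  where
  edge : PathCover s → last s ∨ x ≡ true → ∀ i j → toℕ j ≡ suc (toℕ i) ⊎ (suc (toℕ i) ≡ suc L × toℕ j ≡ 0) →
    lookup s i ∨ lookup s j ≡ true
  edge c wrap i (suc j) (inj₁ 1+j≡1+i)
    with refl ← toℕ-injective {i = i} {inject₁ j} (trans (sym (suc-injective 1+j≡1+i)) (sym (toℕ-inject₁ j))) =
    to (pathCover⇔ s) c j
  edge c wrap i zero (inj₂ (1+i≡1+L , _))
    with refl ← toℕ-injective {i = i} {fromℕ L} (trans (suc-injective 1+i≡1+L) (sym (toℕ-fromℕ L))) =
    subst (λ ℓ → ℓ ∨ x ≡ true) (sym (lookup-fromℕ s)) wrap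

≡-rhs⇔ : ∀ {a b c : ℕ} → b ≡ c → (a ≡ b) ⇔ (a ≡ c)
≡-rhs⇔ b≡c = mk⇔ (λ a≡b → trans a≡b b≡c) (λ a≡c → trans a≡c (sym b≡c))

numberOf-minCycleCovers : ∀ n → 2 ≤ n → NumberOf {n} (λ s → CoversCycle n s × ∣ s ∣ ≡ ⌈ n /2⌉) (2 + (n ∸ 2) * (n % 2))
numberOf-minCycleCovers n 2≤n with parity n
... | suc m , inj₁ refl = subst (NumberOf _) two
  (numberOf-⇔ (λ s → ⇔-sym (coversCycle⇔cycleCover s ×-⇔ ≡-rhs⇔ (⌈double/2⌉ (suc m))) ⇔-∘ ⇔-sym (minCycleCovers-even m s))
    (numberOf-⊎ (λ { s refl () }) (numberOf-singleton (alternating true n)) (numberOf-singleton (alternating false n))))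
  where
  two : 2 ≡ 2 + (n ∸ 2) * (n % 2)
  two = sym (trans (cong (λ r → 2 + (n ∸ 2) * r) (double%2 (suc m))) (cong (2 +_) (*-zeroʳ (n ∸ 2))))
... | suc m , inj₂ refl = subst (NumberOf _) all
  (numberOf-⇔ (λ s → ⇔-sym (coversCycle⇔cycleCover s ×-⇔ ≡-rhs⇔ (⌈1+double/2⌉ (suc m))) ⇔-∘ ⇔-sym (minCycleCovers-odd (suc m) s))
    (numberOf-⊎ alternating-has-no-double-edge (numberOf-singleton (alternating true n)) (numberOf-OneDoubleEdge (double (suc m)))))
  where
  all : n ≡ 2 + (n ∸ 2) * (n % 2)
  all = sym (trans (cong (λ r → 2 + (n ∸ 2) * r) (1+double%2 (suc m))) (cong (2 +_) (*-identityʳ (n ∸ 2))))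
  alternating-has-no-double-edge : ∀ s → s ≡ alternating true n → OneDoubleEdge s → ⊥
  alternating-has-no-double-edge s refl (_ , t≡1) =
    contradiction (trans (sym (alternating-coveredTwice true (double (suc m)))) t≡1) λ ()
... | zero  , inj₁ refl with () ← 2≤n
... | zero  , inj₂ refl with s≤s () ← 2≤n

-- Threshold k = p + 2

module CriticalThreshold (n p : ℕ) where
  open Corona n p

  hubsThenLeaves : Vec Bool n → Fin n → Fin (suc p) → Bool
  hubsThenLeaves s i zero    = lookup s i
  hubsThenLeaves s i (suc _) = true

  withLeaves : Vec Bool n → Subset (n * suc p)
  withLeaves s = onBlocks (hubsThenLeaves s)

  withLeaves-hub : ∀ s i → lookup (withLeaves s) (hub i) ≡ lookup s i
  withLeaves-hub s i = lookup-onBlocks (hubsThenLeaves s) i zero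

  withLeaves-leaf : ∀ s i a → lookup (withLeaves s) (leaf i a) ≡ true
  withLeaves-leaf s i a = lookup-onBlocks (hubsThenLeaves s) i (suc a)

  hubs : Subset (n * suc p) → Vec Bool n
  hubs S = tabulate (lookup S ∘ hub)

  hubs-withLeaves : ∀ s → hubs (withLeaves s) ≡ s
  hubs-withLeaves s = lookup-ext _ s λ i → trans (lookup∘tabulate _ i) (withLeaves-hub s i)

  withLeaves-injective : ∀ {s s′} → withLeaves s ≡ withLeaves s′ → s ≡ s′
  withLeaves-injective {s} {s′} eq = trans (sym (hubs-withLeaves s)) (trans (cong hubs eq) (hubs-withLeaves s′))

  withLeaves-hubs : ∀ S → (∀ i a → lookup S (leaf i a) ≡ true) → S ≡ withLeaves (hubs S)
  withLeaves-hubs S leaves = lookup-ext S _ (vertex-elim _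
    (λ i → sym (trans (withLeaves-hub (hubs S) i) (lookup∘tabulate _ i)))
    (λ i a → trans (leaves i a) (sym (withLeaves-leaf (hubs S) i a))))

  ∣∣-allLeaves : ∀ S → (∀ i a → lookup S (leaf i a) ≡ true) → ∣ S ∣ ≡ ∣ hubs S ∣ + n * p
  ∣∣-allLeaves S leaves = begin
    ∣ S ∣                                                    ≡⟨ ∣∣-blocks S ⟩
    ∑[ i < n ] (bit (lookup S (hub i)) + leavesIn S i)
      ≡⟨ sum-cong-≗ {n} (λ i → cong (bit (lookup S (hub i)) +_) (count-true _ (leaves i))) ⟩
    ∑[ i < n ] (bit (lookup S (hub i)) + p)                  ≡⟨ ∑-distrib-+ (λ i → bit (lookup S (hub i))) (λ _ → p) ⟩
    ∑[ i < n ] bit (lookup S (hub i)) + ∑[ i < n ] p         ≡⟨ cong₂ _+_ (sum-bit (lookup S ∘ hub)) (sum-const n p) ⟩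
    ∣ hubs S ∣ + n * p                                       ∎
    where open ≡-Reasoning

  withLeaves-conversion : 3 ≤ n → ∀ s → CoversCycle n s → IsConversionSet G (2 + p) (withLeaves s)
  withLeaves-conversion 3≤n s covers =
    eventually-coloured⇒conversion G (2 + p) S (vertex-elim _ hubColoured (λ i a → 0 , withLeaves-leaf s i a))
    where
    S : Subset (n * suc p)
    S = withLeaves s

    hubColoured : ∀ i → EventuallyColoured G (2 + p) S (hub i)
    hubColoured i with lookup s i in s-i
    ... | true  = 0 , trans (withLeaves-hub s i) s-i
    ... | false = coloured-by-threshold G (2 + p) S 0 (hub i) (begin
      2 + p                                                          ≡⟨ cong (2 +_) (count-true _ (withLeaves-leaf s i)) ⟨
      2 + leavesIn S i                                               ≤⟨ +-monoˡ-≤ (leavesIn S i) two-coloured-nbrs ⟩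
      count (λ j → cycAdj n i j ∧ lookup S (hub j)) + leavesIn S i    ≡⟨ nbrsIn-hub S i ⟨
      nbrsIn G S (hub i)                                             ∎)
      where
      open ≤-Reasoning
      coloured-nbr : ∀ j → cycAdj n i j ≡ true → lookup s i ∨ lookup s j ≡ true → cycAdj n i j ∧ lookup S (hub j) ≡ true
      coloured-nbr j adj cover = cong₂ _∧_ adj (trans (withLeaves-hub s j) (subst (λ b → b ∨ lookup s j ≡ true) s-i cover))
      two-coloured-nbrs : 2 ≤ count (λ j → cycAdj n i j ∧ lookup S (hub j))
      two-coloured-nbrs = count≥2 _ (cycNext≢cycPrev 3≤n i)
        (coloured-nbr (cycNext i) (cycSucc⇒cycAdj n i (cycNext i) (cycSucc-cycNext i)) (covers i (cycNext i) (cycSucc-cycNext i)))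
        (coloured-nbr (cycPrev i) (trans (cycAdj-sym n i (cycPrev i)) (cycSucc⇒cycAdj n (cycPrev i) i (cycSucc-cycPrev i)))
                      (trans (∨-comm (lookup s i) _) (covers (cycPrev i) i (cycSucc-cycPrev i))))

  conversion⇒leaves : ∀ S → IsConversionSet G (2 + p) S → ∀ i a → lookup S (leaf i a) ≡ true
  conversion⇒leaves S conversion i a with lookup S (leaf i a) in S-leaf
  ... | true  = refl
  ... | false = contradiction conversion (closed⇒¬conversion G (2 + p) {S} {T} (⊆ᵇ-∪ˡ S U) closed (leaf i a) T-leaf)
    where
    U : Subset (n * suc p)
    U = tabulate (leaf i a ≢ᵇ_)
    T : Subset (n * suc p)
    T = S ∪ U

    lookup-T : ∀ y → lookup T y ≡ lookup S y ∨ leaf i a ≢ᵇ y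
    lookup-T y = trans (lookup-∪ S U y) (cong (lookup S y ∨_) (lookup∘tabulate _ y))

    T-leaf : lookup T (leaf i a) ≡ false
    T-leaf = trans (lookup-T (leaf i a)) (cong₂ _∨_ S-leaf (≢ᵇ-irrefl (leaf i a)))

    closed : Closed G (2 + p) T
    closed y T-y with refl ← ≢ᵇ-false⇒≡ (leaf i a) y (∨-conicalʳ _ _ (trans (sym (lookup-T y)) T-y)) = begin-strict
      nbrsIn G T (leaf i a)                               ≤⟨ m≤m+n _ _ ⟩
      nbrsIn G T (leaf i a) + bit (lookup T (leaf i a))   ≡⟨ nbrsIn-leaf T i a ⟩
      bit (lookup T (hub i)) + leavesIn T i               ≤⟨ +-mono-≤ (bit≤1 _) (count≤ _) ⟩
      1 + p                                               <⟨ n<1+n (1 + p) ⟩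
      2 + p                                               ∎
      where open ≤-Reasoning

  hub-bound : ∀ T i j → cycAdj n i j ≡ true → lookup T (hub j) ≡ false → nbrsIn G T (hub i) < 2 + p
  hub-bound T i j adj T-j = begin-strict
    nbrsIn G T (hub i)                                              ≡⟨ nbrsIn-hub T i ⟩
    count (λ l → cycAdj n i l ∧ lookup T (hub l)) + leavesIn T i     ≤⟨ +-mono-≤ one-coloured-nbr (count≤ _) ⟩
    1 + p                                                           <⟨ n<1+n (1 + p) ⟩
    2 + p                                                           ∎
    where
    open ≤-Reasoning
    other-nbrs : count (λ l → j ≢ᵇ l ∧ cycAdj n i l) ≤ 1
    other-nbrs = s≤s⁻¹ (begin
      suc (count (λ l → j ≢ᵇ l ∧ cycAdj n i l))                  ≡⟨ cong (λ b → bit b + count (λ l → j ≢ᵇ l ∧ cycAdj n i l)) adj ⟨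
      bit (cycAdj n i j) + count (λ l → j ≢ᵇ l ∧ cycAdj n i l)   ≡⟨ count-remove (cycAdj n i) j ⟨
      count (cycAdj n i)                                         ≤⟨ cycDegree≤2 n i ⟩
      2                                                          ∎)
    only-other-nbrs : ∀ l → cycAdj n i l ∧ lookup T (hub l) ≡ true → j ≢ᵇ l ∧ cycAdj n i l ≡ true
    only-other-nbrs l coloured with cycAdj n i l | lookup T (hub l) in T-l | j ≢ᵇ l in j≢l
    ... | true | true | true  = refl
    ... | true | true | false with refl ← ≢ᵇ-false⇒≡ j l j≢l = contradiction (trans (sym T-l) T-j) λ ()
    one-coloured-nbr : count (λ l → cycAdj n i l ∧ lookup T (hub l)) ≤ 1
    one-coloured-nbr = ≤-trans (count-mono only-other-nbrs) other-nbrs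

  conversion⇒cover : ∀ S → IsConversionSet G (2 + p) S → CoversCycle n (hubs S)
  conversion⇒cover S conversion i j succ =
    subst₂ (λ a b → a ∨ b ≡ true) (sym (lookup∘tabulate _ i)) (sym (lookup∘tabulate _ j)) hubs-cover
    where
    hubs-cover : lookup S (hub i) ∨ lookup S (hub j) ≡ true
    hubs-cover with lookup S (hub i) in S-i | lookup S (hub j) in S-j
    ... | true  | _     = refl
    ... | false | true  = refl
    ... | false | false = contradiction conversion (closed⇒¬conversion G (2 + p) {S} {T} (⊆ᵇ-∪ˡ S U) closed (hub i) T-i)
      where
      U : Subset (n * suc p)
      U = tabulate (λ y → hub i ≢ᵇ y ∧ hub j ≢ᵇ y)
      T : Subset (n * suc p)
      T = S ∪ U

      lookup-T : ∀ y → lookup T y ≡ lookup S y ∨ (hub i ≢ᵇ y ∧ hub j ≢ᵇ y)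
      lookup-T y = trans (lookup-∪ S U y) (cong (lookup S y ∨_) (lookup∘tabulate _ y))

      T-i : lookup T (hub i) ≡ false
      T-i = trans (lookup-T (hub i)) (cong₂ (λ a b → a ∨ (b ∧ hub j ≢ᵇ hub i)) S-i (≢ᵇ-irrefl (hub i)))

      T-j : lookup T (hub j) ≡ false
      T-j = trans (lookup-T (hub j)) (trans (cong₂ (λ a b → a ∨ (hub i ≢ᵇ hub j ∧ b)) S-j (≢ᵇ-irrefl (hub j))) (∧-zeroʳ _))

      closed : Closed G (2 + p) T
      closed y T-y with hub i ≢ᵇ y in i≢y
      ... | false with refl ← ≢ᵇ-false⇒≡ (hub i) y i≢y = hub-bound T i j (cycSucc⇒cycAdj n i j succ) T-j
      ... | true  with refl ← ≢ᵇ-false⇒≡ (hub j) y (trans (cong (_∧ hub j ≢ᵇ y) (sym i≢y))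
                                                         (∨-conicalʳ _ _ (trans (sym (lookup-T y)) T-y))) =
        hub-bound T j i (trans (cycAdj-sym n j i) (cycSucc⇒cycAdj n i j succ)) T-i

  minCover⇔conversion : 3 ≤ n → ∀ S →
    (∃ λ s → (CoversCycle n s × ∣ s ∣ ≡ ⌈ n /2⌉) × S ≡ withLeaves s) ⇔ SizedConversionSet n p (2 + p) (p * n + ⌈ n /2⌉) S
  minCover⇔conversion 3≤n S = mk⇔
    (λ { (s , (covers , size) , refl) → size-withLeaves s size , withLeaves-conversion 3≤n s covers })
    (λ (size , conversion) → let leaves = conversion⇒leaves S conversion in
      hubs S , (conversion⇒cover S conversion , size-hubs leaves size) , withLeaves-hubs S leaves)
    where
    size-withLeaves : ∀ s → ∣ s ∣ ≡ ⌈ n /2⌉ → ∣ withLeaves s ∣ ≡ p * n + ⌈ n /2⌉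
    size-withLeaves s size = begin
      ∣ withLeaves s ∣                    ≡⟨ ∣∣-allLeaves (withLeaves s) (withLeaves-leaf s) ⟩
      ∣ hubs (withLeaves s) ∣ + n * p     ≡⟨ cong₂ _+_ (trans (cong ∣_∣ (hubs-withLeaves s)) size) (*-comm n p) ⟩
      ⌈ n /2⌉ + p * n                     ≡⟨ +-comm ⌈ n /2⌉ (p * n) ⟩
      p * n + ⌈ n /2⌉                     ∎
      where open ≡-Reasoning
    size-hubs : (∀ i a → lookup S (leaf i a) ≡ true) → ∣ S ∣ ≡ p * n + ⌈ n /2⌉ → ∣ hubs S ∣ ≡ ⌈ n /2⌉
    size-hubs leaves size = +-cancelʳ-≡ (n * p) _ _ (begin
      ∣ hubs S ∣ + n * p     ≡⟨ ∣∣-allLeaves S leaves ⟨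
      ∣ S ∣                  ≡⟨ size ⟩
      p * n + ⌈ n /2⌉        ≡⟨ cong₂ _+_ (*-comm p n) refl ⟩
      n * p + ⌈ n /2⌉        ≡⟨ +-comm (n * p) ⌈ n /2⌉ ⟩
      ⌈ n /2⌉ + n * p        ∎)
      where open ≡-Reasoning

  numberOf-criticalThreshold : 3 ≤ n →
    NumberOf (SizedConversionSet n p (2 + p) (p * n + ⌈ n /2⌉)) (2 + (n ∸ 2) * (n % 2))
  numberOf-criticalThreshold 3≤n = numberOf-⇔ (minCover⇔conversion 3≤n)
    (numberOf-image withLeaves withLeaves-injective (numberOf-minCycleCovers n (≤-trans (n≤1+n 2) 3≤n)))

2+n≰n : ∀ n → 2 + n ≰ n
2+n≰n n = 1+n≰n ∘ ≤-trans (n≤1+n (suc n))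

Ck-low : ∀ n p {k} → k ≤ suc p → Ck n p k ≡ (k ∸ 1) * n + 1
Ck-low n p {k} k≤1+p with k ≤? suc p
... | yes _    = refl
... | no  k≰1+p = contradiction k≤1+p k≰1+p

Ck-critical : ∀ n p → Ck n p (2 + p) ≡ p * n + ⌈ n /2⌉
Ck-critical n p with 2 + p ≤? suc p
... | yes 2+p≤1+p = contradiction 2+p≤1+p 1+n≰n
... | no  _ with 2 + p ≟ 2 + p
...   | yes _  = refl
...   | no  ≢  = contradiction refl ≢

Ck-high : ∀ n p {k} → 3 + p ≤ k → Ck n p k ≡ n * suc p
Ck-high n p {k} 3+p≤k with k ≤? suc p
... | yes k≤1+p = contradiction (≤-trans 3+p≤k k≤1+p) (2+n≰n (suc p))
... | no  _ with k ≟ 2 + p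
...   | yes refl = contradiction 3+p≤k 1+n≰n
...   | no  _    = refl

resize : ∀ {n p k c c′ d} → c ≡ c′ → NumberOf (SizedConversionSet n p k c) d → NumberOf (SizedConversionSet n p k c′) d
resize refl sets = sets

numberOf-low : ∀ n p {k} → 1 ≤ k → k ≤ suc p →
  NumberOf (SizedConversionSet n p k (Ck n p k)) (n * (p C (k ∸ 1)) ^ (n ∸ 1) * (suc p C k))
numberOf-low n p {suc K} _ k≤1+p = resize {n} {p} (sym (Ck-low n p k≤1+p))
  (LowThreshold.numberOf-lowThreshold n p K (s≤s⁻¹ k≤1+p))

numberOf-critical : ∀ n p {k} → k ≡ 2 + p → 3 ≤ n →
  NumberOf (SizedConversionSet n p k (Ck n p k)) (2 + (n ∸ 2) * (n % 2))
numberOf-critical n p refl 3≤n = resize {n} {p} (sym (Ck-critical n p))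
  (CriticalThreshold.numberOf-criticalThreshold n p 3≤n)

numberOf-high : ∀ n p {k} → 3 + p ≤ k → NumberOf (SizedConversionSet n p k (Ck n p k)) 1
numberOf-high n p {k} 3+p≤k = numberOf-⇔ only-⊤ (numberOf-singleton ⊤)
  where
  only-⊤ : ∀ S → S ≡ ⊤ ⇔ SizedConversionSet n p k (Ck n p k) S
  only-⊤ S = mk⇔ (λ { refl → trans (∣⊤∣≡n _) (sym (Ck-high n p 3+p≤k)) , 0 , refl })
                 (λ (size , _) → ∣p∣≡n⇒p≡⊤ (trans size (Ck-high n p 3+p≤k)))

-- Imported only here, since +_ would make the sections (m +_) above ambiguous.
open import Data.Integer using (+_)
open import Data.Rational using (_/_; 1ℚ)

data ThresholdCase (p k : ℕ) : Set where
  low      : k ≤ suc p → ThresholdCase p k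
  critical : k ≡ suc (suc p) → ThresholdCase p k
  high     : suc (suc (suc p)) ≤ k → ThresholdCase p k

thresholdCase : ∀ p k → ThresholdCase p k
thresholdCase p k with <-cmp k (suc (suc p))
... | tri< k<2+p _ _   = low (s≤s⁻¹ k<2+p)
... | tri≈ _ k≡2+p _   = critical k≡2+p
... | tri> _ _ 2+p<k   = high 2+p<k

1/d≡1 : ∀ d .{{_ : NonZero d}} → d ≡ 1 → (+ 1) / d ≡ 1ℚ
1/d≡1 .1 refl = refl

-- The cases are split with
-- case rather than with, since with-abstraction would make Agda normalise the divisions in ℚ.
mainTheorem3 : (n p k : ℕ) → (h3 : 3 ≤ n) → 1 ≤ p → 1 ≤ k →
    Σ ℕ λ cnt →
      NumberOf (λ S → ∣ S ∣ ≡ Ck n p k × IsConversionSet (corona n p) k S) cnt ×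
      (let P = _/_ (+ cnt) ((n * suc p) C Ck n p k) {{binomNZ n p k (3≤⇒1≤ h3)}} in
        (k ≤ suc p → P ≡ _/_ (+ (n * (p C (k ∸ 1)) ^ (n ∸ 1) * (suc p C k))) ((n * suc p) C Ck n p k) {{binomNZ n p k (3≤⇒1≤ h3)}}) ×
        (k ≡ suc (suc p) → P ≡ _/_ (+ (2 + (n ∸ 2) * (n % 2))) ((n * suc p) C Ck n p k) {{binomNZ n p k (3≤⇒1≤ h3)}}) ×
        (suc (suc (suc p)) ≤ k → P ≡ 1ℚ))
mainTheorem3 n p k h3 _ 1≤k = case thresholdCase p k of λ where
  (low k≤1+p) → _ , numberOf-low n p 1≤k k≤1+p ,
    (λ _ → refl) ,
    (λ k≡2+p → contradiction (subst (_≤ suc p) k≡2+p k≤1+p) 1+n≰n) ,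
    (λ 3+p≤k → contradiction (≤-trans 3+p≤k k≤1+p) (2+n≰n (suc p)))
  (critical k≡2+p) → _ , numberOf-critical n p k≡2+p h3 ,
    (λ k≤1+p → contradiction (subst (_≤ suc p) k≡2+p k≤1+p) 1+n≰n) ,
    (λ _ → refl) ,
    (λ 3+p≤k → contradiction (subst (suc (suc (suc p)) ≤_) k≡2+p 3+p≤k) 1+n≰n)
  (high 3+p≤k) → 1 , numberOf-high n p 3+p≤k ,
    (λ k≤1+p → contradiction (≤-trans 3+p≤k k≤1+p) (2+n≰n (suc p))) ,
    (λ k≡2+p → contradiction (subst (suc (suc (suc p)) ≤_) k≡2+p 3+p≤k) 1+n≰n) ,
    (λ _ → 1/d≡1 _ {{binomNZ n p k (3≤⇒1≤ h3)}} (trans (cong (_ C_) (Ck-high n p 3+p≤k)) (nCn≡1 (n * suc p))))
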